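{- Consider the algorithm TRIÈST-BASE with integer parameter $M\ge 6$ run on an insertion-only edge stream (described in the context), and let $\tau^{(t)}$ be the value of its global counter $\tau$ at the end of time step $t$ and $\xi^{(t)}=\xi_{3,t}$. Then $\xi^{(t)}\tau^{(t)}=\tau^{(t)}=|\Delta^{(t)}|$ if $t\le M$, and $\mathbb{E}\left[\xi^{(t)}\tau^{(t)}\right]=|\Delta^{(t)}|$ if $t>M$.
   Context: Insertion-only edge stream: a sequence $e_1,e_2,\dots$ of distinct undirected edges (unordered pairs of distinct vertices) in arbitrary order, fixed independently of the algorithm's random bits; $G^{(t)}=(V^{(t)},E^{(t)})$ is the graph formed by the first $t$ edges, so $|E^{(t)}|=t$. A triangle is a set of three edges $\{(u,v),(v,w),(w,u)\}$ with $u,v,w$ distinct; $\Delta^{(t)}$ is the set of triangles of $G^{(t)}$. For an edge set $\mathcal{S}$, $G^{\mathcal{S}}$ is the graph with edge set $\mathcal{S}$, and $\mathcal{N}^{\mathcal{S}}_{u,v}$ is the set of vertices adjacent in $G^{\mathcal{S}}$ to both $u$ and $v$. TRIÈST-BASE keeps an edge sample $\mathcal{S}$ (initially empty), a global counter $\tau$ (initially $0$) and local counters $\tau_c$ (value $0$ when not stored). The procedure UpdateCounters$(\bullet,(u,v))$, $\bullet\in\{+,-\}$, computes $\mathcal{N}^{\mathcal{S}}_{u,v}$ for the current $\mathcal{S}$ and, for each $c\in\mathcal{N}^{\mathcal{S}}_{u,v}$, adds ($\bullet=+$) or subtracts ($\bullet=-$) $1$ to each of $\tau,\tau_c,\tau_u,\tau_v$.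 At time $t$, when $e_t=(u,v)$ arrives: if $t\le M$, $e_t$ is inserted in $\mathcal{S}$ and UpdateCounters$(+,e_t)$ is called; if $t>M$, a coin with heads probability $M/t$ is flipped (independent randomness); on heads an edge $(u',v')$ chosen uniformly at random from $\mathcal{S}$ is removed from $\mathcal{S}$, UpdateCounters$(-,(u',v'))$ is called, then $e_t$ is inserted in $\mathcal{S}$ and UpdateCounters$(+,e_t)$ is called; on tails nothing changes. For positive integers $a\le\min\{M,b\}$: $\xi_{a,b}=1$ if $b\le M$ and $\xi_{a,b}=\prod_{i=0}^{a-1}\frac{b-i}{M-i}$ otherwise. -}

module Defs where

open import Data.Nat as ℕ using (ℕ; zero; suc; _≤ᵇ_; _<ᵇ_; _≡ᵇ_; _∸_; _≤_; _<_)
open import Data.Integer as ℤ using (ℤ; +_)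
open import Data.Rational as ℚ using (ℚ; _/_; 0ℚ; 1ℚ)
open import Data.Bool using (Bool; true; false; if_then_else_; _∧_; _∨_)
open import Data.List using (List; []; _∷_; map; length; filter; deduplicate; removeAt; allFin; foldr; _++_; concatMap; lookup)
open import Data.Fin using (Fin)
open import Data.List.Relation.Unary.All using (All)
open import Data.List.Relation.Unary.AllPairs using (AllPairs)
open import Data.Product using (_×_; _,_; proj₁; proj₂)
open import Data.Sum using (_⊎_)
open import Relation.Binary.PropositionalEquality using (_≡_; _≢_)
open import Relation.Nullary using (¬_)
open import Relation.Nullary.Decidable using (does)

-- Vertices are natural numbers; an (undirected) edge {u,v} is represented
-- by an ordered pair (u , v); the orientation carries no meaning.
Edge : Set
Edge = ℕ × ℕ

SameEdge : Edge → Edge → Set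
SameEdge (a , b) (c , d) = (a ≡ c × b ≡ d) ⊎ (a ≡ d × b ≡ c)

ValidStream : List Edge → Set
ValidStream es = All (λ e → proj₁ e ≢ proj₂ e) es × AllPairs (λ e f → ¬ SameEdge e f) es

adjacent : List Edge → ℕ → ℕ → Bool
adjacent [] u v = false
adjacent ((a , b) ∷ S) u v =
  ((a ≡ᵇ u) ∧ (b ≡ᵇ v)) ∨ ((a ≡ᵇ v) ∧ (b ≡ᵇ u)) ∨ adjacent S u v

vertices : List Edge → List ℕ
vertices S = deduplicate ℕ._≟_ (concatMap (λ e → proj₁ e ∷ proj₂ e ∷ []) S)

-- number of triangles of the graph with edge list S: a triangle
-- {(u,v),(v,w),(w,u)} corresponds to the unique vertex triple u < v < w
-- that is pairwise adjacent
triples : List ℕ → List (ℕ × ℕ × ℕ)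
triples V = concatMap (λ u → concatMap (λ v → map (λ w → (u , v , w)) V) V) V

isTriangle : List Edge → ℕ × ℕ × ℕ → Bool
isTriangle S (u , v , w) =
  (u <ᵇ v) ∧ (v <ᵇ w) ∧ adjacent S u v ∧ adjacent S v w ∧ adjacent S w u

numTriangles : List Edge → ℕ
numTriangles S = length (filter (λ x → isTriangle S x Data.Bool.≟ true) (triples (vertices S)))
  where import Data.Bool

commonNbrs : List Edge → ℕ → ℕ → List ℕ
commonNbrs S u v = filter (λ c → (adjacent S u c ∧ adjacent S v c) Data.Bool.≟ true) (vertices S)
  where import Data.Bool

Dist : Set → Set
Dist A = List (ℚ × A)

return : {A : Set} → A → Dist A
return x = (1ℚ , x) ∷ []

_>>=_ : {A B : Set} → Dist A → (A → Dist B) → Dist B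
d >>= f = concatMap (λ px → map (λ qy → (proj₁ px ℚ.* proj₁ qy , proj₂ qy)) (f (proj₂ px))) d

𝔼 : {A : Set} → Dist A → (A → ℚ) → ℚ
𝔼 d f = foldr (λ px acc → proj₁ px ℚ.* f (proj₂ px) ℚ.+ acc) 0ℚ d

-- the rational a / d (with the junk value 0 when d = 0)
frac : ℕ → ℕ → ℚ
frac a zero    = 0ℚ
frac a (suc d) = (+ a) / suc d

record State : Set where
  constructor mkState
  field
    sample : List Edge
    τ      : ℤ
    τl     : ℕ → ℤ         -- local counters (0 when not stored)

open State public

initState : State
initState = mkState [] (+ 0) (λ _ → + 0)

data Sign : Set where
  plus minus : Sign

bump : Sign → ℤ → ℤ
bump plus  z = z ℤ.+ + 1
bump minus z = z ℤ.- + 1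

bumpAt : Sign → ℕ → (ℕ → ℤ) → (ℕ → ℤ)
bumpAt s x f y = if x ≡ᵇ y then bump s (f y) else f y

updateCounters : Sign → Edge → State → State
updateCounters s (u , v) st = foldr step st (commonNbrs (sample st) u v)
  where
  step : ℕ → State → State
  step c (mkState S t l) =
    mkState S (bump s t) (bumpAt s v (bumpAt s u (bumpAt s c l)))

insertEdge : Edge → State → State
insertEdge e st = updateCounters plus e (mkState (e ∷ sample st) (τ st) (τl st))

removeIndex : (st : State) → Fin (length (sample st)) → State
removeIndex (mkState S t l) i =
  updateCounters minus (lookup S i) (mkState (removeAt S i) t l)

stepTriest : ℕ → ℕ → Edge → State → Dist State
stepTriest M t e st =
  if t ≤ᵇ M then return (insertEdge e st)
  else (heads ++ tails)
  where
  pH : ℚ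
  pH = frac M t
  -- heads: an edge chosen uniformly at random from 𝒮 (probability 1/M each) is replaced
  heads : Dist State
  heads = map (λ i → (pH ℚ.* frac 1 M , insertEdge e (removeIndex st i))) (allFin (length (sample st)))
  tails : Dist State
  tails = (1ℚ ℚ.- pH , st) ∷ []

-- distribution of the state at the end of processing a stream prefix,
-- given that `t` edges were processed before
runFrom : ℕ → ℕ → List Edge → Dist State → Dist State
runFrom M t [] d = d
runFrom M t (e ∷ es) d = runFrom M (suc t) es (d >>= stepTriest M (suc t) e)

run : ℕ → List Edge → Dist State
run M es = runFrom M 0 es (return initState)

ξ : ℕ → ℕ → ℕ → ℚ
ξ M a b = if b ≤ᵇ M then 1ℚ else prod a
  where
  prod : ℕ → ℚ
  prod zero    = 1ℚ
  prod (suc i) = prod i ℚ.* frac (b ∸ i) (M ∸ i)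

toℚ : ℤ → ℚ
toℚ z = z / 1

module Submission where

-- TRIÈST-BASE keeps τ equal to the number of triangles of its sample: inserting an edge {a,b}
-- creates exactly the triangles {a,b,c} over the common neighbours c of a and b, and removing it destroys them.
-- Up to time M the sample is the whole stream, which gives the exact case. From then on, reservoir sampling puts
-- any k ≤ M given edges of the stream simultaneously into the sample with probability M(M-1)⋯(M-k+1) / t(t-1)⋯(t-k+1);
-- this follows by induction along the stream, treating sets that contain the newly arrived edge separately from
-- those that do not. With k = 3, linearity of expectation over the triangles of the stream gives
-- E[τ] = |Δ| ⋅ M(M-1)(M-2) / t(t-1)(t-2), and ξ_{3,t} is exactly the inverse factor.
-- Triangles and common neighbours are counted as sums over vertices below a bound N on the stream's vertices.

open import Defs
open import Algebra.Bundles using (AbelianGroup; CommutativeMonoid)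
open import Data.Bool as Bool using (Bool; true; false; _∧_; _∨_; not; T)
open import Data.Bool.ListAction using (all; any)
open import Data.Bool.Properties
  using (∨-assoc; ∨-comm; ∨-identityʳ; ∧-assoc; ∧-comm; ∧-identityʳ; ∧-zeroʳ; ∧-conicalˡ; ∧-conicalʳ; ∧-commutativeMonoid)
open import Data.Empty using (⊥-elim)
open import Data.Fin using (Fin; zero; suc)
open import Data.Integer as ℤ using (ℤ; +_)
import Data.Integer.Properties as ℤ
open import Data.List using (List; []; _∷_; _++_; map; concatMap; filter; filterᵇ; foldr; length; allFin; lookup; tabulate; removeAt; _ʳ++_)
open import Data.List.Properties using (tabulate-lookup; map-tabulate; ++-identityʳ; length-filter; length-removeAt′; length-reverse)
open import Data.List.Membership.Propositional using (_∈_; _∉_)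
open import Data.List.Membership.Propositional.Properties using (∈-lookup; ∈-deduplicate⁻; ∈-deduplicate⁺)
open import Data.List.Relation.Binary.Subset.Propositional using (_⊆_)
open import Data.List.Relation.Binary.Subset.Propositional.Properties using (xs⊆x∷xs; ∷⁺ʳ; ⊆-trans)
open import Data.List.Relation.Unary.All using (All; []; _∷_)
import Data.List.Relation.Unary.All as All
open import Data.List.Relation.Unary.All.Properties using (anti-mono; ++⁺; map⁺; tabulate⁺)
open import Data.List.Relation.Unary.AllPairs using (AllPairs; []; _∷_)
import Data.List.Relation.Unary.AllPairs.Properties as AllPairs
open import Data.List.Relation.Unary.Any using (Any; here; there)
import Data.List.Relation.Unary.Any as Any
open import Data.Nat
  using (ℕ; zero; suc; _+_; _*_; _∸_; _≤_; _<_; _⊓_; _⊔_; _≤ᵇ_; _<ᵇ_; _≡ᵇ_; _≟_; _≤?_; s≤s; z≤n; NonZero; >-nonZero; ≢-nonZero⁻¹)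
open import Data.Nat.Properties
open import Data.Nat.Combinatorics.Base using (_P′_)
open import Data.List.Relation.Unary.Unique.DecPropositional.Properties _≟_ using (deduplicate-!)
open import Data.Product using (Σ; _×_; _,_; proj₁; proj₂)
open import Data.Rational as ℚ using (ℚ; 0ℚ; 1ℚ; toℚᵘ)
import Data.Rational.Properties as ℚ
open import Data.Rational.Solver using (module +-*-Solver)
open import Data.Rational.Unnormalised as ℚᵘ using (ℚᵘ; mkℚᵘ; *≡*)
import Data.Rational.Unnormalised.Properties as ℚᵘ
open import Data.Sum using (_⊎_; inj₁; inj₂; [_,_]′)
open import Function using (_∘_)
open import Relation.Binary.Definitions using (tri<; tri≈; tri>)
open import Relation.Binary.PropositionalEquality
open import Relation.Binary.PropositionalEquality using () renaming (trans to infixr 5 _∙_)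
open import Relation.Nullary using (¬_; yes; no)
open import Relation.Nullary.Decidable using (T?)
open import Algebra.Properties.CommutativeSemigroup +-commutativeSemigroup using () renaming (interchange to +-interchange)
open import Algebra.Properties.CommutativeSemigroup *-commutativeSemigroup using (x∙yz≈y∙xz)
open import Algebra.Properties.CommutativeSemigroup (CommutativeMonoid.commutativeSemigroup ∧-commutativeMonoid)
  using () renaming (interchange to ∧-interchange)
open import Algebra.Properties.Group (AbelianGroup.group ℤ.+-0-abelianGroup) using (∙-cancelʳ)

𝟙 : Bool → ℕ
𝟙 true  = 1
𝟙 false = 0

𝟙-false : ∀ {b} → ¬ b ≡ true → 𝟙 b ≡ 0
𝟙-false {true}  b≢true = ⊥-elim (b≢true refl)
𝟙-false {false} _      = refl

𝟙-∨ : ∀ p q → (p ≡ true → q ≡ false) → 𝟙 (p ∨ q) ≡ 𝟙 p + 𝟙 q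
𝟙-∨ true  q excl rewrite excl refl = refl
𝟙-∨ false q _    = refl

𝟙-not : ∀ b → 𝟙 (not b) + 𝟙 b ≡ 1
𝟙-not true  = refl
𝟙-not false = refl

true≢false : true ≢ false
true≢false ()

≢true⇒false : ∀ {b} → b ≢ true → b ≡ false
≢true⇒false {true}  b≢true = ⊥-elim (b≢true refl)
≢true⇒false {false} _      = refl

∨-true : ∀ p q → p ∨ q ≡ true → p ≡ true ⊎ q ≡ true
∨-true true  q _  = inj₁ refl
∨-true false q eq = inj₂ eq

∨-trueʳ : ∀ p {q} → q ≡ true → p ∨ q ≡ true
∨-trueʳ true  refl = refl
∨-trueʳ false refl = refl

not-∨ : ∀ x y → not (x ∨ y) ≡ not x ∧ not y
not-∨ true  y = refl
not-∨ false y = refl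

∧⁵-true : ∀ p₁ p₂ p₃ p₄ p₅ → p₁ ∧ p₂ ∧ p₃ ∧ p₄ ∧ p₅ ≡ true →
          p₁ ≡ true × p₂ ≡ true × p₃ ≡ true × p₄ ≡ true × p₅ ≡ true
∧⁵-true true  true  true  true  true  refl = refl , refl , refl , refl , refl
∧⁵-true false _     _     _     _     ()
∧⁵-true true  false _     _     _     ()
∧⁵-true true  true  false _     _     ()
∧⁵-true true  true  true  false _     ()
∧⁵-true true  true  true  true  false ()

≡ᵇ-true : ∀ {m n} → m ≡ n → (m ≡ᵇ n) ≡ true
≡ᵇ-true {m} {n} m≡n with m ≡ᵇ n | ≡⇒≡ᵇ m n m≡n
... | true | _ = refl

≡ᵇ-sound : ∀ {m n} → (m ≡ᵇ n) ≡ true → m ≡ n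
≡ᵇ-sound {m} {n} eq = ≡ᵇ⇒≡ m n (subst T (sym eq) _)

<ᵇ-true : ∀ {m n} → m < n → (m <ᵇ n) ≡ true
<ᵇ-true {m} {n} m<n with m <ᵇ n | <⇒<ᵇ m<n
... | true | _ = refl

<ᵇ-false : ∀ {m n} → ¬ m < n → (m <ᵇ n) ≡ false
<ᵇ-false {m} {n} m≮n with m <ᵇ n in eq
... | true  = ⊥-elim (m≮n (<ᵇ⇒< m n (subst T (sym eq) _)))
... | false = refl

<ᵇ-sound : ∀ {m n} → (m <ᵇ n) ≡ true → m < n
<ᵇ-sound {m} {n} eq = <ᵇ⇒< m n (subst T (sym eq) _)

≤ᵇ-true : ∀ {m n} → m ≤ n → (m ≤ᵇ n) ≡ true
≤ᵇ-true {m} {n} m≤n with m ≤ᵇ n | ≤⇒≤ᵇ m≤n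
... | true | _ = refl

≤ᵇ-false : ∀ {m n} → n < m → (m ≤ᵇ n) ≡ false
≤ᵇ-false {m} {n} n<m with m ≤ᵇ n in eq
... | true  = ⊥-elim (<⇒≱ n<m (≤ᵇ⇒≤ m n (subst T (sym eq) _)))
... | false = refl

Σ< : ℕ → (ℕ → ℕ) → ℕ
Σ< zero    f = 0
Σ< (suc N) f = Σ< N f + f N

Σ<-cong : ∀ N {f g} → (∀ x → x < N → f x ≡ g x) → Σ< N f ≡ Σ< N g
Σ<-cong zero    h = refl
Σ<-cong (suc N) h = cong₂ _+_ (Σ<-cong N (λ x x<N → h x (m<n⇒m<1+n x<N))) (h N (n<1+n N))

Σ<-zero : ∀ N {f} → (∀ x → x < N → f x ≡ 0) → Σ< N f ≡ 0
Σ<-zero zero    h = refl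
Σ<-zero (suc N) h = cong₂ _+_ (Σ<-zero N (λ x x<N → h x (m<n⇒m<1+n x<N))) (h N (n<1+n N))

Σ<-+ : ∀ N f g → Σ< N (λ x → f x + g x) ≡ Σ< N f + Σ< N g
Σ<-+ zero    f g = refl
Σ<-+ (suc N) f g rewrite Σ<-+ N f g = +-interchange (Σ< N f) (Σ< N g) (f N) (g N)

Σ<-single : ∀ N a {f} → a < N → (∀ x → x < N → x ≢ a → f x ≡ 0) → Σ< N f ≡ f a
Σ<-single zero    a () h
Σ<-single (suc N) a {f} a<1+N h with a ≟ N
... | yes refl = cong (_+ f a) (Σ<-zero N (λ x x<N → h x (m<n⇒m<1+n x<N) (<⇒≢ x<N)))
... | no  a≢N  = begin
  Σ< N f + f N ≡⟨ cong₂ _+_ (Σ<-single N a (≤∧≢⇒< (≤-pred a<1+N) a≢N) (λ x x<N → h x (m<n⇒m<1+n x<N)))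
                            (h N (n<1+n N) (≢-sym a≢N)) ⟩
  f a + 0      ≡⟨ +-identityʳ (f a) ⟩
  f a          ∎
  where open ≡-Reasoning

Σ<²-single : ∀ N a b {f : ℕ → ℕ → ℕ} → a < N → b < N →
             (∀ u v → ¬ (u ≡ a × v ≡ b) → f u v ≡ 0) → Σ< N (λ u → Σ< N (f u)) ≡ f a b
Σ<²-single N a b a<N b<N h =
  trans (Σ<-single N a a<N (λ u _ u≢a → Σ<-zero N (λ v _ → h u v (λ (u≡a , _) → u≢a u≡a))))
        (Σ<-single N b b<N (λ v _ v≢b → h a v (λ (_ , v≡b) → v≢b v≡b)))

Σ<³ : ℕ → (ℕ → ℕ → ℕ → ℕ) → ℕ
Σ<³ N F = Σ< N λ u → Σ< N λ v → Σ< N λ w → F u v w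

Σ<³-cong : ∀ N {F G} → (∀ u v w → F u v w ≡ G u v w) → Σ<³ N F ≡ Σ<³ N G
Σ<³-cong N h = Σ<-cong N λ u _ → Σ<-cong N λ v _ → Σ<-cong N λ w _ → h u v w

Σ<³-+ : ∀ N F G → Σ<³ N (λ u v w → F u v w + G u v w) ≡ Σ<³ N F + Σ<³ N G
Σ<³-+ N F G = Σ<-cong N (λ u _ → Σ<-cong N (λ v _ → Σ<-+ N (F u v) (G u v)) ∙ Σ<-+ N _ _) ∙ Σ<-+ N _ _

Σˡ : {A : Set} → List A → (A → ℕ) → ℕ
Σˡ []       f = 0
Σˡ (x ∷ xs) f = f x + Σˡ xs f

Σˡ-cong : {A : Set} (xs : List A) {f g : A → ℕ} → (∀ x → f x ≡ g x) → Σˡ xs f ≡ Σˡ xs g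
Σˡ-cong []       h = refl
Σˡ-cong (x ∷ xs) h = cong₂ _+_ (h x) (Σˡ-cong xs h)

Σˡ-congᴬ : {A : Set} {xs : List A} {f g : A → ℕ} → All (λ x → f x ≡ g x) xs → Σˡ xs f ≡ Σˡ xs g
Σˡ-congᴬ []       = refl
Σˡ-congᴬ (p ∷ ps) = cong₂ _+_ p (Σˡ-congᴬ ps)

Σˡ-+ : {A : Set} (xs : List A) (f g : A → ℕ) → Σˡ xs (λ x → f x + g x) ≡ Σˡ xs f + Σˡ xs g
Σˡ-+ []       f g = refl
Σˡ-+ (x ∷ xs) f g rewrite Σˡ-+ xs f g = +-interchange (f x) (g x) (Σˡ xs f) (Σˡ xs g)

Σˡ-++ : {A : Set} (xs ys : List A) (f : A → ℕ) → Σˡ (xs ++ ys) f ≡ Σˡ xs f + Σˡ ys f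
Σˡ-++ []       ys f = refl
Σˡ-++ (x ∷ xs) ys f rewrite Σˡ-++ xs ys f = sym (+-assoc (f x) (Σˡ xs f) (Σˡ ys f))

Σˡ-concatMap : {A B : Set} (g : A → List B) (xs : List A) (f : B → ℕ) →
               Σˡ (concatMap g xs) f ≡ Σˡ xs (λ x → Σˡ (g x) f)
Σˡ-concatMap g []       f = refl
Σˡ-concatMap g (x ∷ xs) f = trans (Σˡ-++ (g x) (concatMap g xs) f) (cong (_+_ (Σˡ (g x) f)) (Σˡ-concatMap g xs f))

Σˡ-map : {A B : Set} (g : A → B) (xs : List A) (f : B → ℕ) → Σˡ (map g xs) f ≡ Σˡ xs (λ x → f (g x))
Σˡ-map g []       f = refl
Σˡ-map g (x ∷ xs) f = cong (_+_ (f (g x))) (Σˡ-map g xs f)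

Σˡ-zero : {A : Set} (xs : List A) {f : A → ℕ} → All (λ x → f x ≡ 0) xs → Σˡ xs f ≡ 0
Σˡ-zero []       []       = refl
Σˡ-zero (x ∷ xs) (p ∷ ps) = cong₂ _+_ p (Σˡ-zero xs ps)

Σˡ-1 : {A : Set} (xs : List A) → Σˡ xs (λ _ → 1) ≡ length xs
Σˡ-1 []       = refl
Σˡ-1 (x ∷ xs) = cong suc (Σˡ-1 xs)

length-filter≡Σˡ : {A : Set} (p : A → Bool) (xs : List A) →
                length (filter (λ x → p x Bool.≟ true) xs) ≡ Σˡ xs (λ x → 𝟙 (p x))
length-filter≡Σˡ p []       = refl
length-filter≡Σˡ p (x ∷ xs) with p x
... | true  = cong suc (length-filter≡Σˡ p xs)
... | false = length-filter≡Σˡ p xs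

Σˡ-lookup : {A : Set} (xs : List A) (f : A → ℕ) → Σˡ (allFin (length xs)) (λ i → f (lookup xs i)) ≡ Σˡ xs f
Σˡ-lookup xs f = begin
  Σˡ (allFin (length xs)) (λ i → f (lookup xs i)) ≡⟨ Σˡ-map (lookup xs) (allFin (length xs)) f ⟨
  Σˡ (map (lookup xs) (allFin (length xs))) f    ≡⟨ cong (λ ys → Σˡ ys f) (map-tabulate (λ i → i) (lookup xs)) ⟩
  Σˡ (tabulate (lookup xs)) f                    ≡⟨ cong (λ ys → Σˡ ys f) (tabulate-lookup xs) ⟩
  Σˡ xs f                                        ∎
  where open ≡-Reasoning

Σˡ-Σ< : ∀ N (xs : List ℕ) {f : ℕ → ℕ} → AllPairs _≢_ xs → All (_< N) xs →
        (∀ x → x < N → x ∉ xs → f x ≡ 0) → Σˡ xs f ≡ Σ< N f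
Σˡ-Σ< N []       _ _ h = sym (Σ<-zero N (λ x x<N → h x x<N (λ ())))
Σˡ-Σ< N (a ∷ xs) {f} (a∉xs ∷ distinct) (a<N ∷ bounded) h = begin
  f a + Σˡ xs f                                ≡⟨ cong (_+_ (f a)) (Σˡ-congᴬ (All.map (λ a≢x → sym (erase-≢ (≢-sym a≢x))) a∉xs)) ⟩
  f a + Σˡ xs (erase f)                        ≡⟨ cong (_+_ (f a)) (Σˡ-Σ< N xs distinct bounded erase-off) ⟩
  f a + Σ< N (erase f)                         ≡⟨ cong (_+ Σ< N (erase f)) (trans (sym only-a) (sym (Σ<-single N a a<N (λ x _ → only-≢)))) ⟩
  Σ< N (only f) + Σ< N (erase f)               ≡⟨ sym (Σ<-+ N (only f) (erase f)) ⟩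
  Σ< N (λ x → only f x + erase f x)            ≡⟨ Σ<-cong N (λ x _ → only+erase x) ⟩
  Σ< N f                                       ∎
  where
  open ≡-Reasoning
  only erase : (ℕ → ℕ) → ℕ → ℕ
  only  g x with x ≟ a
  ... | yes _ = g x
  ... | no  _ = 0
  erase g x with x ≟ a
  ... | yes _ = 0
  ... | no  _ = g x
  erase-≢ : ∀ {x} → x ≢ a → erase f x ≡ f x
  erase-≢ {x} x≢a with x ≟ a
  ... | yes x≡a = ⊥-elim (x≢a x≡a)
  ... | no  _   = refl
  only-a : only f a ≡ f a
  only-a with a ≟ a
  ... | yes _   = refl
  ... | no  a≢a = ⊥-elim (a≢a refl)
  only-≢ : ∀ {x} → x ≢ a → only f x ≡ 0
  only-≢ {x} x≢a with x ≟ a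
  ... | yes x≡a = ⊥-elim (x≢a x≡a)
  ... | no  _   = refl
  only+erase : ∀ x → only f x + erase f x ≡ f x
  only+erase x with x ≟ a
  ... | yes _ = +-identityʳ (f x)
  ... | no  _ = refl
  erase-off : ∀ x → x < N → x ∉ xs → erase f x ≡ 0
  erase-off x x<N x∉xs with x ≟ a
  ... | yes _   = refl
  ... | no  x≢a = h x x<N (λ { (here x≡a) → x≢a x≡a ; (there x∈xs) → x∉xs x∈xs })

Loopless : Edge → Set
Loopless e = proj₁ e ≢ proj₂ e

Distinct : List Edge → Set
Distinct = AllPairs (λ e f → ¬ SameEdge e f)

Fresh : Edge → List Edge → Set
Fresh e = All (λ f → ¬ SameEdge e f)

SameEdge-refl : ∀ {e} → SameEdge e e
SameEdge-refl = inj₁ (refl , refl)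

SameEdge-sym : ∀ {e f} → SameEdge e f → SameEdge f e
SameEdge-sym (inj₁ (refl , refl)) = inj₁ (refl , refl)
SameEdge-sym (inj₂ (refl , refl)) = inj₂ (refl , refl)

SameEdge-trans : ∀ {e f g} → SameEdge e f → SameEdge f g → SameEdge e g
SameEdge-trans (inj₁ (refl , refl)) f~g                  = f~g
SameEdge-trans (inj₂ (refl , refl)) (inj₁ (refl , refl)) = inj₂ (refl , refl)
SameEdge-trans (inj₂ (refl , refl)) (inj₂ (refl , refl)) = inj₁ (refl , refl)

sameEdgeᵇ : Edge → Edge → Bool
sameEdgeᵇ (a , b) (x , y) = ((a ≡ᵇ x) ∧ (b ≡ᵇ y)) ∨ ((a ≡ᵇ y) ∧ (b ≡ᵇ x))

sameEdgeᵇ-sound : ∀ e f → sameEdgeᵇ e f ≡ true → SameEdge e f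
sameEdgeᵇ-sound (a , b) (x , y) eq with ∨-true ((a ≡ᵇ x) ∧ (b ≡ᵇ y)) _ eq
... | inj₁ p = inj₁ (≡ᵇ-sound (∧-conicalˡ _ _ p) , ≡ᵇ-sound (∧-conicalʳ _ _ p))
... | inj₂ p = inj₂ (≡ᵇ-sound (∧-conicalˡ _ _ p) , ≡ᵇ-sound (∧-conicalʳ _ _ p))

sameEdgeᵇ-complete : ∀ e f → SameEdge e f → sameEdgeᵇ e f ≡ true
sameEdgeᵇ-complete (a , b) (x , y) (inj₁ (p , q)) rewrite ≡ᵇ-true p | ≡ᵇ-true q = refl
sameEdgeᵇ-complete (a , b) (x , y) (inj₂ (p , q)) rewrite ≡ᵇ-true p | ≡ᵇ-true q = ∨-trueʳ _ refl

sameEdgeᵇ-false : ∀ e f → ¬ SameEdge e f → sameEdgeᵇ e f ≡ false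
sameEdgeᵇ-false e f e≁f = ≢true⇒false (λ eq → e≁f (sameEdgeᵇ-sound e f eq))

sameEdgeᵇ-sym : ∀ e f → sameEdgeᵇ e f ≡ sameEdgeᵇ f e
sameEdgeᵇ-sym e f with sameEdgeᵇ e f in eq
... | true  = sym (sameEdgeᵇ-complete f e (SameEdge-sym (sameEdgeᵇ-sound e f eq)))
... | false = sym (≢true⇒false (λ eq′ → true≢false (trans (sym (sameEdgeᵇ-complete e f
                  (SameEdge-sym (sameEdgeᵇ-sound f e eq′)))) eq)))

sameEdgeᵇ-flip : ∀ e x y → sameEdgeᵇ e (x , y) ≡ sameEdgeᵇ e (y , x)
sameEdgeᵇ-flip (a , b) x y = ∨-comm ((a ≡ᵇ x) ∧ (b ≡ᵇ y)) ((a ≡ᵇ y) ∧ (b ≡ᵇ x))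

adjacent-∷ : ∀ e S x y → adjacent (e ∷ S) x y ≡ sameEdgeᵇ e (x , y) ∨ adjacent S x y
adjacent-∷ (a , b) S x y = sym (∨-assoc ((a ≡ᵇ x) ∧ (b ≡ᵇ y)) ((a ≡ᵇ y) ∧ (b ≡ᵇ x)) (adjacent S x y))

adjacent-sym : ∀ S x y → adjacent S x y ≡ adjacent S y x
adjacent-sym []      x y = refl
adjacent-sym (e ∷ S) x y
  rewrite adjacent-∷ e S x y | adjacent-∷ e S y x | sameEdgeᵇ-flip e x y | adjacent-sym S x y = refl

adjacent⇒Any : ∀ S x y → adjacent S x y ≡ true → Any (λ s → SameEdge s (x , y)) S
adjacent⇒Any (e ∷ S) x y eq rewrite adjacent-∷ e S x y with ∨-true (sameEdgeᵇ e (x , y)) _ eq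
... | inj₁ p = here (sameEdgeᵇ-sound e (x , y) p)
... | inj₂ p = there (adjacent⇒Any S x y p)

Any⇒adjacent : ∀ S x y → Any (λ s → SameEdge s (x , y)) S → adjacent S x y ≡ true
Any⇒adjacent (e ∷ S) x y (here p)  rewrite adjacent-∷ e S x y | sameEdgeᵇ-complete e (x , y) p = refl
Any⇒adjacent (e ∷ S) x y (there p) rewrite adjacent-∷ e S x y = ∨-trueʳ _ (Any⇒adjacent S x y p)

∈⇒adjacent : ∀ S {s x y} → s ∈ S → SameEdge s (x , y) → adjacent S x y ≡ true
∈⇒adjacent S s∈S s~xy = Any⇒adjacent S _ _ (Any.map (λ { refl → s~xy }) s∈S)

adjacent-SameEdge : ∀ S {e f} → SameEdge e f → adjacent S (proj₁ e) (proj₂ e) ≡ adjacent S (proj₁ f) (proj₂ f)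
adjacent-SameEdge S (inj₁ (refl , refl)) = refl
adjacent-SameEdge S (inj₂ (refl , refl)) = adjacent-sym S _ _

¬Any⇒adjacent-false : ∀ S x y → ¬ Any (λ s → SameEdge s (x , y)) S → adjacent S x y ≡ false
¬Any⇒adjacent-false S x y ¬any = ≢true⇒false (λ eq → ¬any (adjacent⇒Any S x y eq))

adjacent-irrefl : ∀ S → All Loopless S → ∀ x → adjacent S x x ≡ false
adjacent-irrefl S loopless x = ¬Any⇒adjacent-false S x x (no-loop S loopless)
  where
  no-loop : ∀ S → All Loopless S → ¬ Any (λ s → SameEdge s (x , x)) S
  no-loop (s ∷ S) (s-loopless ∷ _) (here (inj₁ (p , q))) = s-loopless (trans p (sym q))
  no-loop (s ∷ S) (s-loopless ∷ _) (here (inj₂ (p , q))) = s-loopless (trans p (sym q))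
  no-loop (s ∷ S) (_ ∷ loopless)   (there any)            = no-loop S loopless any

adjacent-fresh : ∀ e S → Fresh e S → adjacent S (proj₁ e) (proj₂ e) ≡ false
adjacent-fresh e S fresh = ¬Any⇒adjacent-false S _ _ (absent S fresh)
  where
  absent : ∀ S → Fresh e S → ¬ Any (λ s → SameEdge s (proj₁ e , proj₂ e)) S
  absent (s ∷ S) (e≁s ∷ _)   (here s~e) = e≁s (SameEdge-sym s~e)
  absent (s ∷ S) (_ ∷ fresh) (there any) = absent S fresh any

removeAt-⊆ : ∀ {A : Set} (xs : List A) i → removeAt xs i ⊆ xs
removeAt-⊆ (x ∷ xs) zero    x∈           = there x∈
removeAt-⊆ (x ∷ xs) (suc i) (here x≡)    = here x≡
removeAt-⊆ (x ∷ xs) (suc i) (there x∈)   = there (removeAt-⊆ xs i x∈)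

Distinct-removeAt : ∀ S i → Distinct S → Distinct (removeAt S i)
Distinct-removeAt (s ∷ S) zero    (_ ∷ distinct)       = distinct
Distinct-removeAt (s ∷ S) (suc i) (fresh ∷ distinct) = anti-mono (removeAt-⊆ S i) fresh ∷ Distinct-removeAt S i distinct

adjacent-removeAt : ∀ S (i : Fin (length S)) → Distinct S → ∀ x y →
  adjacent (removeAt S i) x y ≡ adjacent S x y ∧ not (sameEdgeᵇ (lookup S i) (x , y))
adjacent-removeAt (s ∷ S) zero (s-fresh ∷ _) x y rewrite adjacent-∷ s S x y with sameEdgeᵇ s (x , y) in eq
... | false = sym (∧-identityʳ (adjacent S x y))
... | true  = adjacent-fresh (x , y) S
                (All.map (λ s≁t xy~t → s≁t (SameEdge-trans (sameEdgeᵇ-sound s _ eq) xy~t)) s-fresh)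
adjacent-removeAt (s ∷ S) (suc i) (s-fresh ∷ distinct) x y
  rewrite adjacent-∷ s (removeAt S i) x y | adjacent-∷ s S x y | adjacent-removeAt S i distinct x y
  with sameEdgeᵇ s (x , y) in eq
... | false = refl
... | true  rewrite sameEdgeᵇ-false (lookup S i) (x , y) (λ t~xy → All.lookup s-fresh (∈-lookup i)
                    (SameEdge-trans (sameEdgeᵇ-sound s _ eq) (SameEdge-sym t~xy))) = refl

adjacent-ʳ++ : ∀ R Q x y → adjacent (R ʳ++ Q) x y ≡ adjacent R x y ∨ adjacent Q x y
adjacent-ʳ++ []      Q x y = refl
adjacent-ʳ++ (r ∷ R) Q x y rewrite adjacent-ʳ++ R (r ∷ Q) x y | adjacent-∷ r Q x y | adjacent-∷ r R x y
  = ∨-rotate (adjacent R x y) (sameEdgeᵇ r (x , y)) (adjacent Q x y)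
  where
  ∨-rotate : ∀ a s q → a ∨ (s ∨ q) ≡ (s ∨ a) ∨ q
  ∨-rotate a s q = trans (sym (∨-assoc a s q)) (cong (_∨ q) (∨-comm a s))

-- Triangles

Graph : Set
Graph = ℕ → ℕ → Bool

triangle³ᵇ : Graph → Graph → Graph → ℕ → ℕ → ℕ → Bool
triangle³ᵇ r₁ r₂ r₃ u v w = (u <ᵇ v) ∧ (v <ᵇ w) ∧ r₁ u v ∧ r₂ v w ∧ r₃ w u

triangleᵇ : Graph → ℕ → ℕ → ℕ → Bool
triangleᵇ adj = triangle³ᵇ adj adj adj

triangle³ᵇ-true : ∀ r₁ r₂ r₃ u v w → triangle³ᵇ r₁ r₂ r₃ u v w ≡ true →
                  u < v × v < w × r₁ u v ≡ true × r₂ v w ≡ true × r₃ w u ≡ true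
triangle³ᵇ-true r₁ r₂ r₃ u v w t with ∧⁵-true (u <ᵇ v) (v <ᵇ w) (r₁ u v) (r₂ v w) (r₃ w u) t
... | u<v , v<w , p₁ , p₂ , p₃ = <ᵇ-sound u<v , <ᵇ-sound v<w , p₁ , p₂ , p₃

triangles< : ℕ → Graph → ℕ
triangles< N adj = Σ<³ N λ u v w → 𝟙 (triangleᵇ adj u v w)

commonNeighbours< : ℕ → Graph → ℕ → ℕ → ℕ
commonNeighbours< N adj a b = Σ< N λ c → 𝟙 (adj a c ∧ adj b c)

triangles<-cong : ∀ N {adj adj′ : Graph} → (∀ x y → adj x y ≡ adj′ x y) → triangles< N adj ≡ triangles< N adj′
triangles<-cong N h = Σ<³-cong N λ u v w →
  cong 𝟙 (cong₂ (λ p q → (u <ᵇ v) ∧ (v <ᵇ w) ∧ p ∧ q) (h u v) (cong₂ _∧_ (h v w) (h w u)))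

triangles<-empty : ∀ N → triangles< N (λ _ _ → false) ≡ 0
triangles<-empty N = Σ<-zero N λ u _ → Σ<-zero N λ v _ → Σ<-zero N λ w _ →
  cong 𝟙 (cong ((u <ᵇ v) ∧_) (∧-zeroʳ (v <ᵇ w)) ∙ ∧-zeroʳ (u <ᵇ v))

𝟙-∧∨³ : ∀ P Q R p q r → P ∧ p ≡ false → Q ∧ q ≡ false → R ∧ r ≡ false →
        P ∧ Q ≡ false → P ∧ R ≡ false → Q ∧ R ≡ false →
        𝟙 ((P ∨ p) ∧ (Q ∨ q) ∧ (R ∨ r)) ≡ 𝟙 (p ∧ q ∧ r) + 𝟙 (P ∧ q ∧ r) + 𝟙 (p ∧ Q ∧ r) + 𝟙 (p ∧ q ∧ R)
𝟙-∧∨³ true  _     _     _     q     r     refl _    _    refl refl _    = sym (+-identityʳ _ ∙ +-identityʳ (𝟙 (q ∧ r)))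
𝟙-∧∨³ false true  _     true  _     r     _    refl _    _    _    refl = sym (+-identityʳ (𝟙 r))
𝟙-∧∨³ false true  _     false _     r     _    refl _    _    _    refl = refl
𝟙-∧∨³ false false true  true  true  _     _    _    refl _    _    _    = refl
𝟙-∧∨³ false false true  true  false _     _    _    refl _    _    _    = refl
𝟙-∧∨³ false false true  false q     _     _    _    refl _    _    _    = refl
𝟙-∧∨³ false false false true  true  r     _    _    _    _    _    _    = sym (+-identityʳ _ ∙ +-identityʳ _ ∙ +-identityʳ (𝟙 r))
𝟙-∧∨³ false false false true  false r     _    _    _    _    _    _    = refl
𝟙-∧∨³ false false false false q     r     _    _    _    _    _    _    = refl

module EdgeInsertion (adj : Graph) (a b : ℕ) where

  E : Graph
  E x y = sameEdgeᵇ (a , b) (x , y)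

  adj⁺ : Graph
  adj⁺ x y = E x y ∨ adj x y

  E-cases : ∀ {x y} → E x y ≡ true → (x ≡ a × y ≡ b) ⊎ (x ≡ b × y ≡ a)
  E-cases {x} {y} e with sameEdgeᵇ-sound (a , b) (x , y) e
  ... | inj₁ (p , q) = inj₁ (sym p , sym q)
  ... | inj₂ (p , q) = inj₂ (sym q , sym p)

  E-self : E a b ≡ true
  E-self = sameEdgeᵇ-complete (a , b) (a , b) SameEdge-refl

  E-sym : ∀ x y → E x y ≡ E y x
  E-sym x y = sameEdgeᵇ-flip (a , b) x y

  E-swap : E b a ≡ true
  E-swap = sameEdgeᵇ-complete (a , b) (b , a) (inj₂ (refl , refl))

  E∧E : ∀ {x y x′ y′} → ¬ SameEdge (x , y) (x′ , y′) → E x y ∧ E x′ y′ ≡ false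
  E∧E {x} {y} {x′} {y′} different with E x y in e | E x′ y′ in e′
  ... | false | _     = refl
  ... | true  | false = refl
  ... | true  | true  = ⊥-elim (different (SameEdge-trans (SameEdge-sym (sameEdgeᵇ-sound (a , b) _ e))
                                                        (sameEdgeᵇ-sound (a , b) _ e′)))

  X₁ X₂ X₃ : ℕ → ℕ → ℕ → ℕ
  X₁ u v w = 𝟙 (triangle³ᵇ E adj adj u v w)
  X₂ u v w = 𝟙 (triangle³ᵇ adj E adj u v w)
  X₃ u v w = 𝟙 (triangle³ᵇ adj adj E u v w)

  -- Splitting the triangles of adj⁺ by which of their sides is the new edge {a,b}: for a < b each kind is a triangle
  -- {a,b,c} with c beyond b, below a, or between them, so together they count the common neighbours of a and b.
  module Ordered (N : ℕ) (adj-sym : ∀ x y → adj x y ≡ adj y x) (adj-irrefl : ∀ x → adj x x ≡ false)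
                 (ab-new : adj a b ≡ false) (a<N : a < N) (b<N : b < N) (a<b : a < b) where

    E∧adj : ∀ x y → E x y ∧ adj x y ≡ false
    E∧adj x y with E x y in e
    ... | false = refl
    ... | true with E-cases e
    ...   | inj₁ (refl , refl) = ab-new
    ...   | inj₂ (refl , refl) = trans (adj-sym b a) ab-new

    triangle-split : ∀ u v w → 𝟙 (triangleᵇ adj⁺ u v w) ≡ 𝟙 (triangleᵇ adj u v w) + X₁ u v w + X₂ u v w + X₃ u v w
    triangle-split u v w with u <ᵇ v in uv | v <ᵇ w in vw
    ... | false | _     = refl
    ... | true  | false = refl
    ... | true  | true  = 𝟙-∧∨³ (E u v) (E v w) (E w u) (adj u v) (adj v w) (adj w u)
                            (E∧adj u v) (E∧adj v w) (E∧adj w u)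
                            (E∧E (λ { (inj₁ (p , q)) → <⇒≢ u<w (trans p q) ; (inj₂ (p , _)) → <⇒≢ u<w p }))
                            (E∧E (λ { (inj₁ (p , _)) → <⇒≢ u<w p ; (inj₂ (_ , q)) → <⇒≢ v<w q }))
                            (E∧E (λ { (inj₁ (p , _)) → <⇒≢ v<w p ; (inj₂ (p , _)) → <⇒≢ u<v (sym p) }))
      where
      u<v = <ᵇ-sound uv
      v<w = <ᵇ-sound vw
      u<w = <-trans u<v v<w

    E-ordered : ∀ {x y} → x < y → E x y ≡ true → x ≡ a × y ≡ b
    E-ordered x<y e with E-cases e
    ... | inj₁ xy≡ab         = xy≡ab
    ... | inj₂ (refl , refl) = ⊥-elim (<-asym a<b x<y)

    -- In X_i the new edge occupies a fixed side of u < v < w, which pins down two of the vertices.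
    X₁-off : ∀ u v w → ¬ (u ≡ a × v ≡ b) → X₁ u v w ≡ 0
    X₁-off u v w off = 𝟙-false λ t → let (u<v , _ , e , _) = triangle³ᵇ-true E adj adj u v w t in off (E-ordered u<v e)

    X₂-off : ∀ u v w → ¬ (v ≡ a × w ≡ b) → X₂ u v w ≡ 0
    X₂-off u v w off = 𝟙-false λ t → let (_ , v<w , _ , e , _) = triangle³ᵇ-true adj E adj u v w t in off (E-ordered v<w e)

    X₃-off : ∀ u v w → ¬ (u ≡ a × w ≡ b) → X₃ u v w ≡ 0
    X₃-off u v w off = 𝟙-false λ t → let (u<v , v<w , _ , _ , e) = triangle³ᵇ-true adj adj E u v w t in
      off (E-ordered (<-trans u<v v<w) (trans (E-sym u w) e))

    X₂-at : ∀ c → X₂ c a b ≡ 𝟙 ((c <ᵇ a) ∧ adj c a ∧ adj b c)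
    X₂-at c = cong₂ (λ p q → 𝟙 ((c <ᵇ a) ∧ p ∧ adj c a ∧ q ∧ adj b c)) (<ᵇ-true a<b) E-self

    X₃-at : ∀ c → X₃ a c b ≡ 𝟙 ((a <ᵇ c) ∧ (c <ᵇ b) ∧ adj a c ∧ adj c b)
    X₃-at c = cong (λ p → 𝟙 ((a <ᵇ c) ∧ (c <ᵇ b) ∧ adj a c ∧ adj c b ∧ p)) E-swap
            ∙ cong (λ p → 𝟙 ((a <ᵇ c) ∧ (c <ᵇ b) ∧ adj a c ∧ p)) (∧-identityʳ (adj c b))

    X₁-at : ∀ c → X₁ a b c ≡ 𝟙 ((b <ᵇ c) ∧ adj b c ∧ adj c a)
    X₁-at c = cong₂ (λ p q → 𝟙 (p ∧ (b <ᵇ c) ∧ q ∧ adj b c ∧ adj c a)) (<ᵇ-true a<b) E-self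

    sum-X₁ : Σ<³ N X₁ ≡ Σ< N (λ c → X₁ a b c)
    sum-X₁ = Σ<²-single N a b a<N b<N (λ u v off → Σ<-zero N (λ w _ → X₁-off u v w off))

    sum-X₂ : Σ<³ N X₂ ≡ Σ< N (λ c → X₂ c a b)
    sum-X₂ = Σ<-cong N (λ u _ → Σ<²-single N a b a<N b<N (λ v w off → X₂-off u v w off))

    sum-X₃ : Σ<³ N X₃ ≡ Σ< N (λ c → X₃ a c b)
    sum-X₃ = Σ<-single N a a<N (λ u _ u≢a → Σ<-zero N λ v _ → Σ<-zero N λ w _ → X₃-off u v w (λ (u≡a , _) → u≢a u≡a))
           ∙ Σ<-cong N (λ v _ → Σ<-single N b b<N (λ w _ w≢b → X₃-off a v w (λ (_ , w≡b) → w≢b w≡b)))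

    common-neighbour-split : ∀ c → X₁ a b c + X₂ c a b + X₃ a c b ≡ 𝟙 (adj a c ∧ adj b c)
    common-neighbour-split c rewrite X₁-at c | X₂-at c | X₃-at c | adj-sym c a | adj-sym c b with <-cmp c a
    ... | tri< c<a _ _ rewrite <ᵇ-false {b} {c} (<-asym (<-trans c<a a<b)) | <ᵇ-true c<a | <ᵇ-false {a} {c} (<-asym c<a)
        = +-identityʳ _
    ... | tri≈ _ refl _ rewrite <ᵇ-false {b} {c} (<-asym a<b) | <ᵇ-false {c} {c} (<-irrefl refl) | adj-irrefl c = refl
    ... | tri> _ _ a<c with <-cmp c b
    ...   | tri< c<b _ _ rewrite <ᵇ-false {b} {c} (<-asym c<b) | <ᵇ-false {c} {a} (<-asym a<c) | <ᵇ-true a<c | <ᵇ-true c<b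
        = refl
    ...   | tri≈ _ refl _ rewrite <ᵇ-false {c} {c} (<-irrefl refl) | <ᵇ-false {c} {a} (<-asym a<c) | <ᵇ-true a<c
                                | adj-irrefl c = sym (cong 𝟙 (∧-zeroʳ (adj a c)))
    ...   | tri> _ _ b<c rewrite <ᵇ-true b<c | <ᵇ-false {c} {a} (<-asym a<c) | <ᵇ-false {c} {b} (<-asym b<c) | <ᵇ-true a<c
        = +-identityʳ _ ∙ +-identityʳ _ ∙ cong 𝟙 (∧-comm (adj b c) (adj a c))

    triangles-insert : triangles< N adj⁺ ≡ triangles< N adj + commonNeighbours< N adj a b
    triangles-insert = begin
      triangles< N adj⁺
        ≡⟨ Σ<³-cong N triangle-split ⟩
      Σ<³ N (λ u v w → 𝟙 (triangleᵇ adj u v w) + X₁ u v w + X₂ u v w + X₃ u v w)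
        ≡⟨ Σ<³-+ N _ X₃ ∙ cong (_+ Σ<³ N X₃) (Σ<³-+ N _ X₂ ∙ cong (_+ Σ<³ N X₂) (Σ<³-+ N _ X₁)) ⟩
      triangles< N adj + Σ<³ N X₁ + Σ<³ N X₂ + Σ<³ N X₃
        ≡⟨ cong₂ _+_ (cong₂ (λ p q → triangles< N adj + p + q) sum-X₁ sum-X₂) sum-X₃ ⟩
      triangles< N adj + Σ< N F₁ + Σ< N F₂ + Σ< N F₃
        ≡⟨ +-assoc (triangles< N adj + Σ< N F₁) _ _ ∙ +-assoc (triangles< N adj) _ _ ⟩
      triangles< N adj + (Σ< N F₁ + (Σ< N F₂ + Σ< N F₃))
        ≡⟨ cong (λ s → triangles< N adj + (Σ< N F₁ + s)) (Σ<-+ N F₂ F₃) ⟨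
      triangles< N adj + (Σ< N F₁ + Σ< N (λ c → F₂ c + F₃ c))
        ≡⟨ cong (_+_ (triangles< N adj)) (Σ<-cong N (λ c _ → +-assoc (F₁ c) _ _) ∙ Σ<-+ N F₁ _) ⟨
      triangles< N adj + Σ< N (λ c → F₁ c + F₂ c + F₃ c)
        ≡⟨ cong (_+_ (triangles< N adj)) (Σ<-cong N (λ c _ → common-neighbour-split c)) ⟩
      triangles< N adj + commonNeighbours< N adj a b ∎
      where
      open ≡-Reasoning
      F₁ F₂ F₃ : ℕ → ℕ
      F₁ c = X₁ a b c
      F₂ c = X₂ c a b
      F₃ c = X₃ a c b

  E-irrefl : a ≢ b → ∀ x → E x x ≡ false
  E-irrefl a≢b x = ≢true⇒false λ e →
    a≢b ([ (λ (x≡a , x≡b) → trans (sym x≡a) x≡b) , (λ (x≡b , x≡a) → trans (sym x≡a) x≡b) ]′ (E-cases e))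

  common-neighbour-insert : (∀ x → adj x x ≡ false) → a ≢ b → ∀ c → 𝟙 (adj⁺ a c ∧ adj⁺ b c) ≡ 𝟙 (adj a c ∧ adj b c)
  common-neighbour-insert adj-irrefl a≢b c with c ≟ a | c ≟ b
  ... | yes refl | _ rewrite E-irrefl a≢b c | adj-irrefl c = refl
  ... | no _ | yes refl rewrite E-irrefl a≢b c | adj-irrefl c | ∧-zeroʳ (adj⁺ a c) | ∧-zeroʳ (adj a c) = refl
  ... | no c≢a | no c≢b = cong₂ (λ p q → 𝟙 ((p ∨ adj a c) ∧ (q ∨ adj b c)))
          (≢true⇒false λ e → [ (λ (_ , c≡b) → c≢b c≡b) , (λ (a≡b , _) → a≢b a≡b) ]′ (E-cases e))
          (≢true⇒false λ e → [ (λ (b≡a , _) → a≢b (sym b≡a)) , (λ (_ , c≡a) → c≢a c≡a) ]′ (E-cases e))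

triangles<-insert : ∀ N adj a b → (∀ x y → adj x y ≡ adj y x) → (∀ x → adj x x ≡ false) →
  adj a b ≡ false → a ≢ b → a < N → b < N →
  triangles< N (λ x y → sameEdgeᵇ (a , b) (x , y) ∨ adj x y) ≡ triangles< N adj + commonNeighbours< N adj a b
triangles<-insert N adj a b adj-sym adj-irrefl ab-new a≢b a<N b<N with <-cmp a b
... | tri< a<b _ _ = EdgeInsertion.Ordered.triangles-insert adj a b N adj-sym adj-irrefl ab-new a<N b<N a<b
... | tri≈ _ a≡b _ = ⊥-elim (a≢b a≡b)
... | tri> _ _ b<a = begin
  triangles< N (λ x y → sameEdgeᵇ (a , b) (x , y) ∨ adj x y)
    ≡⟨ triangles<-cong N (λ x y → cong (_∨ adj x y) (swap-edge x y)) ⟩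
  triangles< N (λ x y → sameEdgeᵇ (b , a) (x , y) ∨ adj x y)
    ≡⟨ EdgeInsertion.Ordered.triangles-insert adj b a N adj-sym adj-irrefl (trans (adj-sym b a) ab-new) b<N a<N b<a ⟩
  triangles< N adj + commonNeighbours< N adj b a
    ≡⟨ cong (_+_ (triangles< N adj)) (Σ<-cong N (λ c _ → cong 𝟙 (∧-comm (adj b c) (adj a c)))) ⟩
  triangles< N adj + commonNeighbours< N adj a b ∎
  where
  open ≡-Reasoning
  swap-edge : ∀ x y → sameEdgeᵇ (a , b) (x , y) ≡ sameEdgeᵇ (b , a) (x , y)
  swap-edge x y = sameEdgeᵇ-sym (a , b) (x , y) ∙ sameEdgeᵇ-flip (x , y) a b ∙ sameEdgeᵇ-sym (x , y) (b , a)

commonNeighbours<-insert : ∀ N adj a b → (∀ x → adj x x ≡ false) → a ≢ b →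
  commonNeighbours< N (λ x y → sameEdgeᵇ (a , b) (x , y) ∨ adj x y) a b ≡ commonNeighbours< N adj a b
commonNeighbours<-insert N adj a b adj-irrefl a≢b =
  Σ<-cong N (λ c _ → EdgeInsertion.common-neighbour-insert adj a b adj-irrefl a≢b c)

Bounded : ℕ → Edge → Set
Bounded N e = proj₁ e < N × proj₂ e < N

endpoints : Edge → List ℕ
endpoints e = proj₁ e ∷ proj₂ e ∷ []

vertices-bounded : ∀ N S → All (Bounded N) S → All (_< N) (vertices S)
vertices-bounded N S bounded =
  All.tabulate λ x∈V → endpoint-bounded S bounded (∈-deduplicate⁻ _≟_ (concatMap endpoints S) x∈V)
  where
  endpoint-bounded : ∀ S → All (Bounded N) S → ∀ {x} → x ∈ concatMap endpoints S → x < N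
  endpoint-bounded (e ∷ S) ((a<N , _) ∷ _) (here refl)         = a<N
  endpoint-bounded (e ∷ S) ((_ , b<N) ∷ _) (there (here refl)) = b<N
  endpoint-bounded (e ∷ S) (_ ∷ bounded)   (there (there x∈))  = endpoint-bounded S bounded x∈

adjacent-non-vertex : ∀ S {u v} → v ∉ vertices S → adjacent S u v ≡ false
adjacent-non-vertex S {u} {v} v∉V =
  ≢true⇒false λ eq → v∉V (∈-deduplicate⁺ _≟_ (endpoint S (adjacent⇒Any S u v eq)))
  where
  endpoint : ∀ S → Any (λ s → SameEdge s (u , v)) S → v ∈ concatMap endpoints S
  endpoint (e ∷ S) (here (inj₁ (_ , refl))) = there (here refl)
  endpoint (e ∷ S) (here (inj₂ (refl , _))) = here refl
  endpoint (e ∷ S) (there any)              = there (there (endpoint S any))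

numTriangles≡triangles< : ∀ N S → All (Bounded N) S → numTriangles S ≡ triangles< N (adjacent S)
numTriangles≡triangles< N S bounded = begin
  numTriangles S
    ≡⟨ length-filter≡Σˡ (isTriangle S) (triples V) ⟩
  Σˡ (triples V) (λ x → 𝟙 (isTriangle S x))
    ≡⟨ Σˡ-concatMap _ V _ ∙ Σˡ-cong V (λ u → Σˡ-concatMap _ V _ ∙ Σˡ-cong V (λ v → Σˡ-map _ V _)) ⟩
  Σˡ V (λ u → Σˡ V (λ v → Σˡ V (λ w → 𝟙 (triangleᵇ adj u v w))))
    ≡⟨ Σˡ-cong V (λ u → Σˡ-cong V (λ v → Σˡ-Σ< N V distinct V<N (λ w _ w∉V → off-w u v w w∉V))) ⟩
  Σˡ V (λ u → Σˡ V (λ v → Σ< N (λ w → 𝟙 (triangleᵇ adj u v w))))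
    ≡⟨ Σˡ-cong V (λ u → Σˡ-Σ< N V distinct V<N (λ v _ v∉V → Σ<-zero N (λ w _ → off-v u v w v∉V))) ⟩
  Σˡ V (λ u → Σ< N (λ v → Σ< N (λ w → 𝟙 (triangleᵇ adj u v w))))
    ≡⟨ Σˡ-Σ< N V distinct V<N (λ u _ u∉V → Σ<-zero N (λ v _ → Σ<-zero N (λ w _ → off-u u v w u∉V))) ⟩
  triangles< N adj ∎
  where
  open ≡-Reasoning
  V = vertices S
  adj = adjacent S
  distinct = deduplicate-! (concatMap endpoints S)
  V<N = vertices-bounded N S bounded
  off-u : ∀ u v w → u ∉ V → 𝟙 (triangleᵇ adj u v w) ≡ 0
  off-u u v w u∉V = 𝟙-false λ t → let (_ , _ , _ , _ , wu) = triangle³ᵇ-true adj adj adj u v w t in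
    true≢false (trans (sym wu) (adjacent-non-vertex S u∉V))
  off-v : ∀ u v w → v ∉ V → 𝟙 (triangleᵇ adj u v w) ≡ 0
  off-v u v w v∉V = 𝟙-false λ t → let (_ , _ , uv , _ , _) = triangle³ᵇ-true adj adj adj u v w t in
    true≢false (trans (sym uv) (adjacent-non-vertex S v∉V))
  off-w : ∀ u v w → w ∉ V → 𝟙 (triangleᵇ adj u v w) ≡ 0
  off-w u v w w∉V = 𝟙-false λ t → let (_ , _ , _ , vw , _) = triangle³ᵇ-true adj adj adj u v w t in
    true≢false (trans (sym vw) (adjacent-non-vertex S w∉V))

length-commonNbrs : ∀ N S a b → All (Bounded N) S → length (commonNbrs S a b) ≡ commonNeighbours< N (adjacent S) a b
length-commonNbrs N S a b bounded = length-filter≡Σˡ (λ c → adjacent S a c ∧ adjacent S b c) (vertices S)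
  ∙ Σˡ-Σ< N (vertices S) (deduplicate-! (concatMap endpoints S)) (vertices-bounded N S bounded)
      (λ c _ c∉V → cong (λ p → 𝟙 (p ∧ adjacent S b c)) (adjacent-non-vertex S c∉V))

maxVertex : List Edge → ℕ
maxVertex []             = 0
maxVertex ((a , b) ∷ es) = a ⊔ b ⊔ maxVertex es

Bounded-maxVertex : ∀ es → All (Bounded (suc (maxVertex es))) es
Bounded-maxVertex []             = []
Bounded-maxVertex ((a , b) ∷ es) =
  (s≤s (≤-trans (m≤m⊔n a b) (m≤m⊔n (a ⊔ b) _)) , s≤s (≤-trans (m≤n⊔m a b) (m≤m⊔n (a ⊔ b) _)))
  ∷ All.map (λ (a<N , b<N) → (weaken a<N , weaken b<N)) (Bounded-maxVertex es)
  where
  weaken : ∀ {x} → x < suc (maxVertex es) → x < suc (a ⊔ b ⊔ maxVertex es)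
  weaken x<N = <-≤-trans x<N (s≤s (m≤n⊔m (a ⊔ b) (maxVertex es)))

-- The counters

-- Defs keeps the step of updateCounters local; this copy is definitionally that step.
counterStep : Sign → ℕ → ℕ → ℕ → State → State
counterStep s u v c (mkState S t l) = mkState S (bump s t) (bumpAt s v (bumpAt s u (bumpAt s c l)))

sample-counterSteps : ∀ s u v st L → sample (foldr (counterStep s u v) st L) ≡ sample st
sample-counterSteps s u v st []      = refl
sample-counterSteps s u v st (c ∷ L) = sample-counterSteps s u v st L

τ-counterSteps-plus : ∀ u v st L → τ (foldr (counterStep plus u v) st L) ≡ τ st ℤ.+ + length L
τ-counterSteps-plus u v st []      = sym (ℤ.+-identityʳ (τ st))
τ-counterSteps-plus u v st (c ∷ L) rewrite τ-counterSteps-plus u v st L =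
  ℤ.+-assoc (τ st) (+ length L) (+ 1) ∙ cong (λ k → τ st ℤ.+ k) (ℤ.+-comm (+ length L) (+ 1))

τ-counterSteps-minus : ∀ u v st L → τ (foldr (counterStep minus u v) st L) ℤ.+ + length L ≡ τ st
τ-counterSteps-minus u v st []      = ℤ.+-identityʳ (τ st)
τ-counterSteps-minus u v st (c ∷ L) = begin
  (τ′ ℤ.- + 1) ℤ.+ (+ 1 ℤ.+ + length L)      ≡⟨ ℤ.+-assoc τ′ (ℤ.- + 1) (+ 1 ℤ.+ + length L) ⟩
  τ′ ℤ.+ (ℤ.- + 1 ℤ.+ (+ 1 ℤ.+ + length L))  ≡⟨ cong (λ k → τ′ ℤ.+ k) (ℤ.+-assoc (ℤ.- + 1) (+ 1) (+ length L)) ⟨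
  τ′ ℤ.+ + length L                          ≡⟨ τ-counterSteps-minus u v st L ⟩
  τ st                                       ∎
  where
  open ≡-Reasoning
  τ′ = τ (foldr (counterStep minus u v) st L)

CountsTriangles : ℕ → State → Set
CountsTriangles N st = τ st ≡ + triangles< N (adjacent (sample st))

sample-insertEdge : ∀ e st → sample (insertEdge e st) ≡ e ∷ sample st
sample-insertEdge (a , b) st = sample-counterSteps plus a b _ (commonNbrs ((a , b) ∷ sample st) a b)

sample-removeIndex : ∀ st i → sample (removeIndex st i) ≡ removeAt (sample st) i
sample-removeIndex (mkState S t l) i =
  sample-counterSteps minus u v (mkState (removeAt S i) t l) (commonNbrs (removeAt S i) u v)
  where
  u = proj₁ (lookup S i)
  v = proj₂ (lookup S i)

module _ (N : ℕ) where

  -- The counters are updated with the common neighbours in the enlarged sample, which are those of the old one.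
  insertEdge-counts : ∀ e st → Loopless e → Bounded N e → Fresh e (sample st) →
    All Loopless (sample st) → All (Bounded N) (sample st) → CountsTriangles N st → CountsTriangles N (insertEdge e st)
  insertEdge-counts e@(a , b) st a≢b (a<N , b<N) fresh loopless bounded counts = begin
    τ (insertEdge e st)                                      ≡⟨ τ-counterSteps-plus a b _ (commonNbrs (e ∷ S) a b) ⟩
    τ st ℤ.+ + length (commonNbrs (e ∷ S) a b)               ≡⟨ cong₂ (λ x k → x ℤ.+ + k) counts common ⟩
    + triangles< N adj ℤ.+ + commonNeighbours< N adj a b     ≡⟨ cong +_ (triangles<-insert N adj a b adj-sym irrefl new a≢b a<N b<N) ⟨
    + triangles< N (λ x y → sameEdgeᵇ e (x , y) ∨ adj x y)   ≡⟨ cong +_ (triangles<-cong N (λ x y → sym (adjacent-∷ e S x y))) ⟩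
    + triangles< N (adjacent (e ∷ S))                         ≡⟨ cong (λ S′ → + triangles< N (adjacent S′)) (sym (sample-insertEdge e st)) ⟩
    + triangles< N (adjacent (sample (insertEdge e st)))     ∎
    where
    open ≡-Reasoning
    S = sample st
    adj = adjacent S
    adj-sym = adjacent-sym S
    irrefl = adjacent-irrefl S loopless
    new = adjacent-fresh e S fresh
    common : length (commonNbrs (e ∷ S) a b) ≡ commonNeighbours< N adj a b
    common = length-commonNbrs N (e ∷ S) a b ((a<N , b<N) ∷ bounded)
           ∙ Σ<-cong N (λ c _ → cong₂ (λ p q → 𝟙 (p ∧ q)) (adjacent-∷ e S a c) (adjacent-∷ e S b c))
           ∙ commonNeighbours<-insert N adj a b irrefl a≢b

  removeIndex-counts : ∀ st i → Distinct (sample st) → All Loopless (sample st) → All (Bounded N) (sample st) →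
    CountsTriangles N st → CountsTriangles N (removeIndex st i)
  removeIndex-counts st@(mkState S t l) i distinct loopless bounded counts = ∙-cancelʳ (+ k) _ _ (begin
    τ (removeIndex st i) ℤ.+ + k                               ≡⟨ τ-counterSteps-minus a b (mkState S′ t l) (commonNbrs S′ a b) ⟩
    t                                                          ≡⟨ counts ⟩
    + triangles< N (adjacent S)                                ≡⟨ cong +_ (triangles<-cong N adjacent-restore) ⟩
    + triangles< N (λ x y → sameEdgeᵇ (a , b) (x , y) ∨ adj′ x y)
        ≡⟨ cong +_ (triangles<-insert N adj′ a b (adjacent-sym S′) (adjacent-irrefl S′ loopless′) removed a≢b a<N b<N) ⟩
    + (triangles< N adj′ + commonNeighbours< N adj′ a b)     ≡⟨ ℤ.pos-+ (triangles< N adj′) _ ∙ cong (λ c → + triangles< N adj′ ℤ.+ + c) (sym common) ⟩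
    + triangles< N adj′ ℤ.+ + k                                ≡⟨ cong (λ S″ → + triangles< N (adjacent S″) ℤ.+ + k) (sym (sample-removeIndex st i)) ⟩
    + triangles< N (adjacent (sample (removeIndex st i))) ℤ.+ + k ∎)
    where
    open ≡-Reasoning
    e = lookup S i
    a = proj₁ e
    b = proj₂ e
    S′ = removeAt S i
    adj′ = adjacent S′
    k = length (commonNbrs S′ a b)
    loopless′ = anti-mono (removeAt-⊆ S i) loopless
    a≢b : a ≢ b
    a≢b = All.lookup loopless (∈-lookup i)
    a<N = proj₁ (All.lookup bounded (∈-lookup i))
    b<N = proj₂ (All.lookup bounded (∈-lookup i))
    common : k ≡ commonNeighbours< N adj′ a b
    common = length-commonNbrs N S′ a b (anti-mono (removeAt-⊆ S i) bounded)
    removed : adj′ a b ≡ false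
    removed = adjacent-removeAt S i distinct a b ∙ cong (λ p → adjacent S a b ∧ not p) (sameEdgeᵇ-complete e (a , b) SameEdge-refl)
            ∙ ∧-zeroʳ _
    adjacent-restore : ∀ x y → adjacent S x y ≡ sameEdgeᵇ (a , b) (x , y) ∨ adj′ x y
    adjacent-restore x y rewrite adjacent-removeAt S i distinct x y with sameEdgeᵇ e (x , y) in same
    ... | true  = ∈⇒adjacent S (∈-lookup i) (sameEdgeᵇ-sound e (x , y) same)
    ... | false = sym (∧-identityʳ _)

⟦_⟧ : ℕ → ℚ
⟦ n ⟧ = frac n 1

-- Used instead of evaluation, which would have to run the gcd inside the normalisation of ℚ.
⟦0⟧≡0ℚ : ⟦ 0 ⟧ ≡ 0ℚ
⟦0⟧≡0ℚ = ℚ.0/n≡0 1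

private
  frac≃mkℚᵘ : ∀ a b → toℚᵘ (frac a (suc b)) ℚᵘ.≃ mkℚᵘ (+ a) b
  frac≃mkℚᵘ a b = ℚ.toℚᵘ-fromℚᵘ (mkℚᵘ (+ a) b)

frac-≡ : ∀ a b c d .{{_ : NonZero b}} .{{_ : NonZero d}} → a * d ≡ c * b → frac a b ≡ frac c d
frac-≡ a (suc b) c (suc d) ad≡cb =
  ℚ.fromℚᵘ-cong {mkℚᵘ (+ a) b} {mkℚᵘ (+ c) d} (*≡* (sym (ℤ.pos-* a (suc d)) ∙ cong +_ ad≡cb ∙ ℤ.pos-* c (suc b)))

frac-* : ∀ a b c d .{{_ : NonZero b}} .{{_ : NonZero d}} → frac a b ℚ.* frac c d ≡ frac (a * c) (b * d)
frac-* a (suc b) c (suc d) = ℚ.toℚᵘ-injective (ℚᵘ.≃-trans (ℚ.toℚᵘ-homo-* (frac a (suc b)) (frac c (suc d)))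
  (ℚᵘ.≃-trans (ℚᵘ.*-cong (frac≃mkℚᵘ a b) (frac≃mkℚᵘ c d))
  (ℚᵘ.≃-trans (*≡* (cong (ℤ._* + suc (d + b * suc d)) (sym (ℤ.pos-* a c))))
               (ℚᵘ.≃-sym (frac≃mkℚᵘ (a * c) (d + b * suc d))))))

frac-+ : ∀ a b c d .{{_ : NonZero b}} .{{_ : NonZero d}} → frac a b ℚ.+ frac c d ≡ frac (a * d + c * b) (b * d)
frac-+ a (suc b) c (suc d) = ℚ.toℚᵘ-injective (ℚᵘ.≃-trans (ℚ.toℚᵘ-homo-+ (frac a (suc b)) (frac c (suc d)))
  (ℚᵘ.≃-trans (ℚᵘ.+-cong (frac≃mkℚᵘ a b) (frac≃mkℚᵘ c d))
  (ℚᵘ.≃-trans (*≡* (cong (ℤ._* + suc (d + b * suc d)) numerator))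
               (ℚᵘ.≃-sym (frac≃mkℚᵘ (a * suc d + c * suc b) (d + b * suc d))))))
  where
  numerator : + a ℤ.* + suc d ℤ.+ + c ℤ.* + suc b ≡ + (a * suc d + c * suc b)
  numerator = cong₂ ℤ._+_ (sym (ℤ.pos-* a (suc d))) (sym (ℤ.pos-* c (suc b))) ∙ sym (ℤ.pos-+ (a * suc d) (c * suc b))

frac-self : ∀ n .{{_ : NonZero n}} → frac n n ≡ 1ℚ
frac-self n = frac-≡ n n 1 1 (*-identityʳ n ∙ sym (*-identityˡ n))

frac-cancelˡ : ∀ x a b .{{_ : NonZero x}} .{{_ : NonZero b}} .{{_ : NonZero (x * b)}} → frac (x * a) (x * b) ≡ frac a b
frac-cancelˡ x a b = frac-≡ (x * a) (x * b) a b (*-assoc x a b ∙ x∙yz≈y∙xz x a b)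

frac-1* : ∀ a x d .{{_ : NonZero d}} → frac 1 d ℚ.* ⟦ a * x ⟧ ≡ frac a d ℚ.* ⟦ x ⟧
frac-1* a x d = frac-* 1 d (a * x) 1 ∙ cong (λ k → frac k (d * 1)) (*-identityˡ (a * x)) ∙ sym (frac-* a d x 1)

frac-+-distrib : ∀ a b d y .{{_ : NonZero d}} → frac a d ℚ.* y ℚ.+ frac b d ℚ.* y ≡ frac (a + b) d ℚ.* y
frac-+-distrib a b d y = sym (ℚ.*-distribʳ-+ y (frac a d) (frac b d)) ∙ cong (ℚ._* y) sum
  where
  instance _ = m*n≢0 d d
  sum : frac a d ℚ.+ frac b d ≡ frac (a + b) d
  sum = frac-+ a d b d ∙ frac-≡ (a * d + b * d) (d * d) (a + b) d (cong (_* d) (sym (*-distribʳ-+ d a b)) ∙ *-assoc (a + b) d d)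

frac-*-frac-1 : ∀ a d .{{_ : NonZero a}} .{{_ : NonZero d}} → frac a d ℚ.* frac 1 a ≡ frac 1 d
frac-*-frac-1 a d = frac-* a d 1 a
  ∙ frac-≡ (a * 1) (d * a) 1 d {{m*n≢0 d a}} (cong (_* d) (*-identityʳ a) ∙ *-comm a d ∙ sym (*-identityˡ (d * a)))

frac-inverse : ∀ a b .{{_ : NonZero a}} .{{_ : NonZero b}} → frac a b ℚ.* frac b a ≡ 1ℚ
frac-inverse a b = frac-* a b b a
  ∙ frac-≡ (a * b) (b * a) 1 1 {{m*n≢0 b a}} (*-identityʳ (a * b) ∙ *-comm a b ∙ sym (*-identityˡ (b * a)))

⟦⟧-+ : ∀ m n → ⟦ m + n ⟧ ≡ ⟦ m ⟧ ℚ.+ ⟦ n ⟧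
⟦⟧-+ m n = sym (frac-+ m 1 n 1 ∙ cong (λ k → frac k 1) (cong₂ _+_ (*-identityʳ m) (*-identityʳ n)))

1-frac : ∀ m n .{{_ : NonZero n}} → m ≤ n → 1ℚ ℚ.- frac m n ≡ frac (n ∸ m) n
1-frac m n m≤n = begin
  1ℚ ℚ.- frac m n                           ≡⟨ cong (ℚ._- frac m n) (sym (frac-self n)) ⟩
  frac n n ℚ.- frac m n                     ≡⟨ cong (λ k → frac k n ℚ.- frac m n) (sym (m∸n+n≡m m≤n)) ⟩
  frac (n ∸ m + m) n ℚ.- frac m n           ≡⟨ cong (ℚ._- frac m n) (sym (ℚ.*-identityʳ (frac (n ∸ m + m) n)) ∙ sym (frac-+-distrib (n ∸ m) m n 1ℚ)
                                                 ∙ cong₂ ℚ._+_ (ℚ.*-identityʳ (frac (n ∸ m) n)) (ℚ.*-identityʳ (frac m n))) ⟩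
  frac (n ∸ m) n ℚ.+ frac m n ℚ.- frac m n ≡⟨ x+y-y≡x (frac (n ∸ m) n) (frac m n) ⟩
  frac (n ∸ m) n                            ∎
  where
  open ≡-Reasoning
  open +-*-Solver
  x+y-y≡x : ∀ x y → x ℚ.+ y ℚ.- y ≡ x
  x+y-y≡x = solve 2 (λ x y → x :+ y :- y := x) refl

*-left-comm : ∀ x y z → x ℚ.* (y ℚ.* z) ≡ y ℚ.* (x ℚ.* z)
*-left-comm = solve 3 (λ x y z → x :* (y :* z) := y :* (x :* z)) refl
  where open +-*-Solver

P′-nonZero : ∀ {n k} → k ≤ n → NonZero (n P′ k)
P′-nonZero {n} {zero}  _   = _
P′-nonZero {n} {suc k} k<n = m*n≢0 (n ∸ k) (n P′ k) {{>-nonZero (m<n⇒0<n∸m k<n)}} {{P′-nonZero (<⇒≤ k<n)}}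

P′-suc : ∀ n k → suc n P′ suc k ≡ suc n * (n P′ k)
P′-suc n zero    = refl
P′-suc n (suc k) = cong ((n ∸ k) *_) (P′-suc n k) ∙ x∙yz≈y∙xz (n ∸ k) (suc n) (n P′ k)

-- π M k t = M(M-1)⋯(M-k+1) / t(t-1)⋯(t-k+1) is the probability that k given edges among the first t ≥ M
-- all sit in the reservoir.
π : ℕ → ℕ → ℕ → ℚ
π M k t = frac (M P′ k) (t P′ k)

module _ {M k : ℕ} where

  π-self : k ≤ M → π M k M ≡ 1ℚ
  π-self k≤M = frac-self (M P′ k) {{P′-nonZero k≤M}}

  π-survive : ∀ t → k ≤ t → frac (suc t ∸ k) (suc t) ℚ.* π M k t ≡ π M k (suc t)
  π-survive t k≤t = begin
    frac (suc t ∸ k) (suc t) ℚ.* frac (M P′ k) (t P′ k)   ≡⟨ frac-* (suc t ∸ k) (suc t) (M P′ k) (t P′ k) ⟩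
    frac ((suc t ∸ k) * (M P′ k)) (suc t * (t P′ k))        ≡⟨ cong (frac _) (sym (P′-suc t k)) ⟩
    frac ((suc t ∸ k) * (M P′ k)) ((suc t ∸ k) * (suc t P′ k)) ≡⟨ frac-cancelˡ (suc t ∸ k) (M P′ k) (suc t P′ k) ⟩
    frac (M P′ k) (suc t P′ k)                             ∎
    where
    open ≡-Reasoning
    instance
      _ = P′-nonZero k≤t
      _ = P′-nonZero (m≤n⇒m≤1+n k≤t)
      _ = >-nonZero (m<n⇒0<n∸m (s≤s k≤t))
      _ = P′-nonZero {suc t} {suc k} (s≤s k≤t)

  π-enter : ∀ t → k ≤ t → frac (M ∸ k) (suc t) ℚ.* π M k t ≡ π M (suc k) (suc t)
  π-enter t k≤t = frac-* (M ∸ k) (suc t) (M P′ k) (t P′ k) {{_}} {{P′-nonZero k≤t}}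
                ∙ cong (frac (M P′ suc k)) (sym (P′-suc t k))

falling-ratio-suc : ∀ M t k → k < M → M ≤ t →
  frac (t P′ k) (M P′ k) ℚ.* frac (t ∸ k) (M ∸ k) ≡ frac (t P′ suc k) (M P′ suc k)
falling-ratio-suc M t k k<M M≤t =
  frac-* (t P′ k) (M P′ k) (t ∸ k) (M ∸ k) {{P′-nonZero (<⇒≤ k<M)}} {{>-nonZero (m<n⇒0<n∸m k<M)}}
  ∙ frac-≡ _ _ _ _ {{m*n≢0 _ _ {{P′-nonZero (<⇒≤ k<M)}} {{>-nonZero (m<n⇒0<n∸m k<M)}}}} {{P′-nonZero k<M}}
      (cong₂ _*_ (*-comm (t P′ k) (t ∸ k)) (sym (*-comm (M P′ k) (M ∸ k))))

ξ-π : ∀ M t → 3 ≤ M → M < t → ξ M 3 t ℚ.* π M 3 t ≡ 1ℚ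
ξ-π M t 3≤M M<t rewrite ≤ᵇ-false M<t = begin
  ((1ℚ ℚ.* frac t M) ℚ.* frac (t ∸ 1) (M ∸ 1)) ℚ.* frac (t ∸ 2) (M ∸ 2) ℚ.* π M 3 t
    ≡⟨ cong (λ r → r ℚ.* π M 3 t) (cong (λ r → r ℚ.* frac (t ∸ 2) (M ∸ 2)) (cong (λ r → r ℚ.* frac (t ∸ 1) (M ∸ 1))
         (falling-ratio-suc M t 0 0<M M≤t) ∙ falling-ratio-suc M t 1 1<M M≤t) ∙ falling-ratio-suc M t 2 3≤M M≤t) ⟩
  frac (t P′ 3) (M P′ 3) ℚ.* frac (M P′ 3) (t P′ 3)
    ≡⟨ frac-inverse (t P′ 3) (M P′ 3) {{P′-nonZero (≤-trans 3≤M M≤t)}} {{P′-nonZero 3≤M}} ⟩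
  1ℚ ∎
  where
  open ≡-Reasoning
  M≤t = <⇒≤ M<t
  0<M = <-≤-trans (s≤s z≤n) 3≤M
  1<M = <-≤-trans (s≤s (s≤s z≤n)) 3≤M

-- Expectation

Always : {A : Set} → (A → Set) → Dist A → Set
Always P = All (λ px → P (proj₂ px))

Always-bind : ∀ {A B : Set} {P : B → Set} (d : Dist A) (k : A → Dist B) →
              Always (λ x → Always P (k x)) d → Always P (d >>= k)
Always-bind []            k []       = []
Always-bind ((p , x) ∷ d) k (a ∷ as) = ++⁺ (map⁺ a) (Always-bind d k as)

>>=-identityˡ : ∀ {A B : Set} (x : A) (k : A → Dist B) → return x >>= k ≡ k x
>>=-identityˡ x k = ++-identityʳ _ ∙ weigh-1 (k x)
  where
  weigh-1 : ∀ d → map (λ qy → (1ℚ ℚ.* proj₁ qy , proj₂ qy)) d ≡ d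
  weigh-1 []            = refl
  weigh-1 ((q , y) ∷ d) = cong₂ (λ p d′ → (p , y) ∷ d′) (ℚ.*-identityˡ q) (weigh-1 d)

module _ {A : Set} where

  𝔼-return : ∀ (x : A) f → 𝔼 (return x) f ≡ f x
  𝔼-return x f = ℚ.+-identityʳ (1ℚ ℚ.* f x) ∙ ℚ.*-identityˡ (f x)

  𝔼-++ : ∀ (d d′ : Dist A) f → 𝔼 (d ++ d′) f ≡ 𝔼 d f ℚ.+ 𝔼 d′ f
  𝔼-++ []            d′ f = sym (ℚ.+-identityˡ (𝔼 d′ f))
  𝔼-++ ((p , x) ∷ d) d′ f rewrite 𝔼-++ d d′ f = sym (ℚ.+-assoc (p ℚ.* f x) (𝔼 d f) (𝔼 d′ f))

  𝔼-cong : ∀ (d : Dist A) {f g} → Always (λ x → f x ≡ g x) d → 𝔼 d f ≡ 𝔼 d g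
  𝔼-cong []            []       = refl
  𝔼-cong ((p , x) ∷ d) (e ∷ es) = cong₂ (λ y z → p ℚ.* y ℚ.+ z) e (𝔼-cong d es)

  𝔼-congᵖ : ∀ (d : Dist A) {f g} → (∀ x → f x ≡ g x) → 𝔼 d f ≡ 𝔼 d g
  𝔼-congᵖ []            h = refl
  𝔼-congᵖ ((p , x) ∷ d) h = cong₂ (λ y z → p ℚ.* y ℚ.+ z) (h x) (𝔼-congᵖ d h)

  𝔼-scale : ∀ (d : Dist A) c f → 𝔼 d (λ x → c ℚ.* f x) ≡ c ℚ.* 𝔼 d f
  𝔼-scale []            c f = sym (ℚ.*-zeroʳ c)
  𝔼-scale ((p , x) ∷ d) c f rewrite 𝔼-scale d c f = lemma p c (f x) (𝔼 d f)
    where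
    open +-*-Solver
    lemma : ∀ p c y e → p ℚ.* (c ℚ.* y) ℚ.+ c ℚ.* e ≡ c ℚ.* (p ℚ.* y ℚ.+ e)
    lemma = solve 4 (λ p c y e → p :* (c :* y) :+ c :* e := c :* (p :* y :+ e)) refl

  𝔼-+ : ∀ (d : Dist A) f g → 𝔼 d (λ x → f x ℚ.+ g x) ≡ 𝔼 d f ℚ.+ 𝔼 d g
  𝔼-+ []            f g = refl
  𝔼-+ ((p , x) ∷ d) f g rewrite 𝔼-+ d f g = lemma p (f x) (g x) (𝔼 d f) (𝔼 d g)
    where
    open +-*-Solver
    lemma : ∀ p a b e e′ → p ℚ.* (a ℚ.+ b) ℚ.+ (e ℚ.+ e′) ≡ (p ℚ.* a ℚ.+ e) ℚ.+ (p ℚ.* b ℚ.+ e′)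
    lemma = solve 5 (λ p a b e e′ → p :* (a :+ b) :+ (e :+ e′) := (p :* a :+ e) :+ (p :* b :+ e′)) refl

  𝔼-0 : ∀ (d : Dist A) → 𝔼 d (λ _ → 0ℚ) ≡ 0ℚ
  𝔼-0 []            = refl
  𝔼-0 ((p , x) ∷ d) rewrite 𝔼-0 d = ℚ.+-identityʳ (p ℚ.* 0ℚ) ∙ ℚ.*-zeroʳ p

  𝔼-⟦0⟧ : ∀ (d : Dist A) p → 𝔼 d (λ _ → ⟦ 0 ⟧) ≡ ⟦ 0 ⟧ ℚ.* p
  𝔼-⟦0⟧ d p = 𝔼-congᵖ d (λ _ → ⟦0⟧≡0ℚ) ∙ 𝔼-0 d ∙ sym (ℚ.*-zeroˡ p) ∙ cong (ℚ._* p) (sym ⟦0⟧≡0ℚ)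

  𝔼-weight : ∀ w (d : Dist A) f → 𝔼 (map (λ qy → (w ℚ.* proj₁ qy , proj₂ qy)) d) f ≡ w ℚ.* 𝔼 d f
  𝔼-weight w []            f = sym (ℚ.*-zeroʳ w)
  𝔼-weight w ((q , y) ∷ d) f rewrite 𝔼-weight w d f = lemma w q (f y) (𝔼 d f)
    where
    open +-*-Solver
    lemma : ∀ w q y e → w ℚ.* q ℚ.* y ℚ.+ w ℚ.* e ≡ w ℚ.* (q ℚ.* y ℚ.+ e)
    lemma = solve 4 (λ w q y e → w :* q :* y :+ w :* e := w :* (q :* y :+ e)) refl

  𝔼-bind : ∀ {B : Set} (d : Dist B) (k : B → Dist A) f → 𝔼 (d >>= k) f ≡ 𝔼 d (λ x → 𝔼 (k x) f)
  𝔼-bind []            k f = refl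
  𝔼-bind ((p , x) ∷ d) k f = 𝔼-++ (map (λ qy → (p ℚ.* proj₁ qy , proj₂ qy)) (k x)) (d >>= k) f
                           ∙ cong₂ ℚ._+_ (𝔼-weight p (k x) f) (𝔼-bind d k f)

  𝔼-uniform : ∀ {Ix : Set} w (L : List Ix) (g : Ix → A) (h : A → ℕ) →
              𝔼 (map (λ i → (w , g i)) L) (λ x → ⟦ h x ⟧) ≡ w ℚ.* ⟦ Σˡ L (λ i → h (g i)) ⟧
  𝔼-uniform w []      g h = sym (cong (w ℚ.*_) ⟦0⟧≡0ℚ ∙ ℚ.*-zeroʳ w)
  𝔼-uniform w (i ∷ L) g h rewrite 𝔼-uniform w L g h | ⟦⟧-+ (h (g i)) (Σˡ L (λ i → h (g i))) =
    sym (ℚ.*-distribˡ-+ w ⟦ h (g i) ⟧ ⟦ Σˡ L (λ i → h (g i)) ⟧)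

  𝔼-Σ< : ∀ (d : Dist A) N (f : A → ℕ → ℕ) (g : ℕ → ℕ) c →
         (∀ x → x < N → 𝔼 d (λ s → ⟦ f s x ⟧) ≡ ⟦ g x ⟧ ℚ.* c) →
         𝔼 d (λ s → ⟦ Σ< N (f s) ⟧) ≡ ⟦ Σ< N g ⟧ ℚ.* c
  𝔼-Σ< d zero    f g c h = 𝔼-⟦0⟧ d c
  𝔼-Σ< d (suc N) f g c h = begin
    𝔼 d (λ s → ⟦ Σ< N (f s) + f s N ⟧)                          ≡⟨ 𝔼-congᵖ d (λ s → ⟦⟧-+ (Σ< N (f s)) (f s N)) ⟩
    𝔼 d (λ s → ⟦ Σ< N (f s) ⟧ ℚ.+ ⟦ f s N ⟧)                     ≡⟨ 𝔼-+ d _ _ ⟩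
    𝔼 d (λ s → ⟦ Σ< N (f s) ⟧) ℚ.+ 𝔼 d (λ s → ⟦ f s N ⟧)        ≡⟨ cong₂ ℚ._+_ (𝔼-Σ< d N f g c (λ x x<N → h x (m<n⇒m<1+n x<N))) (h N (n<1+n N)) ⟩
    ⟦ Σ< N g ⟧ ℚ.* c ℚ.+ ⟦ g N ⟧ ℚ.* c                           ≡⟨ ℚ.*-distribʳ-+ c ⟦ Σ< N g ⟧ ⟦ g N ⟧ ⟨
    (⟦ Σ< N g ⟧ ℚ.+ ⟦ g N ⟧) ℚ.* c                              ≡⟨ cong (ℚ._* c) (⟦⟧-+ (Σ< N g) (g N)) ⟨
    ⟦ Σ< N g + g N ⟧ ℚ.* c                                      ∎
    where open ≡-Reasoning

_⊑ᵇ_ : List Edge → List Edge → Bool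
A ⊑ᵇ S = all (λ x → adjacent S (proj₁ x) (proj₂ x)) A

occursᵇ : Edge → List Edge → Bool
occursᵇ e = any (sameEdgeᵇ e)

deleteEdge : Edge → List Edge → List Edge
deleteEdge e = filterᵇ (λ f → not (sameEdgeᵇ e f))

⊑ᵇ-∷ : ∀ e S A → A ⊑ᵇ (e ∷ S) ≡ deleteEdge e A ⊑ᵇ S
⊑ᵇ-∷ e S []      = refl
⊑ᵇ-∷ e S (f ∷ A) rewrite adjacent-∷ e S (proj₁ f) (proj₂ f) with sameEdgeᵇ e f
... | true  = ⊑ᵇ-∷ e S A
... | false = cong (adjacent S (proj₁ f) (proj₂ f) ∧_) (⊑ᵇ-∷ e S A)

deleteEdge-absent : ∀ e A → occursᵇ e A ≡ false → deleteEdge e A ≡ A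
deleteEdge-absent e []      _      = refl
deleteEdge-absent e (f ∷ A) absent with sameEdgeᵇ e f
... | false = cong (f ∷_) (deleteEdge-absent e A absent)

Distinct-deleteEdge : ∀ e A → Distinct A → Distinct (deleteEdge e A)
Distinct-deleteEdge e A = AllPairs.filter⁺ (λ f → T? (not (sameEdgeᵇ e f)))

length-deleteEdge-≤ : ∀ e A → length (deleteEdge e A) ≤ length A
length-deleteEdge-≤ e = length-filter (λ f → T? (not (sameEdgeᵇ e f)))

occursᵇ-fresh : ∀ s f B → sameEdgeᵇ s f ≡ true → Fresh f B → occursᵇ s B ≡ false
occursᵇ-fresh s f []      _   _                 = refl
occursᵇ-fresh s f (g ∷ B) s~f (f≁g ∷ f-fresh) with sameEdgeᵇ s g in s~g
... | true  = ⊥-elim (f≁g (SameEdge-trans (SameEdge-sym (sameEdgeᵇ-sound s f s~f)) (sameEdgeᵇ-sound s g s~g)))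
... | false = occursᵇ-fresh s f B s~f f-fresh

length-deleteEdge-occurs : ∀ e A → Distinct A → occursᵇ e A ≡ true → suc (length (deleteEdge e A)) ≡ length A
length-deleteEdge-occurs e (f ∷ A) (f-fresh ∷ distinct) occurs with sameEdgeᵇ e f in e~f
... | true  = cong (suc ∘ length) (deleteEdge-absent e A (occursᵇ-fresh e f A e~f f-fresh))
... | false = cong suc (length-deleteEdge-occurs e A distinct occurs)

⊑ᵇ-non-edge : ∀ S e A → occursᵇ e A ≡ true → adjacent S (proj₁ e) (proj₂ e) ≡ false → A ⊑ᵇ S ≡ false
⊑ᵇ-non-edge S e (f ∷ A) occurs non-edge with sameEdgeᵇ e f in e~f
... | true  rewrite sym (adjacent-SameEdge S (sameEdgeᵇ-sound e f e~f)) | non-edge = refl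
... | false = ∧-zeroʳ-if (⊑ᵇ-non-edge S e A occurs non-edge)
  where
  ∧-zeroʳ-if : ∀ {p q} → q ≡ false → p ∧ q ≡ false
  ∧-zeroʳ-if {p} refl = ∧-zeroʳ p

⊑ᵇ-removeAt : ∀ S i A → Distinct S → A ⊑ᵇ removeAt S i ≡ A ⊑ᵇ S ∧ not (occursᵇ (lookup S i) A)
⊑ᵇ-removeAt S i []      distinct = refl
⊑ᵇ-removeAt S i (f ∷ A) distinct
  rewrite adjacent-removeAt S i distinct (proj₁ f) (proj₂ f) | ⊑ᵇ-removeAt S i A distinct
        | not-∨ (sameEdgeᵇ (lookup S i) f) (occursᵇ (lookup S i) A)
  = ∧-interchange (adjacent S (proj₁ f) (proj₂ f)) _ _ _

Σ-sameEdge : ∀ S f → Distinct S → adjacent S (proj₁ f) (proj₂ f) ≡ true → Σˡ S (λ s → 𝟙 (sameEdgeᵇ s f)) ≡ 1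
Σ-sameEdge (s ∷ S) f (s-fresh ∷ distinct) f∈S rewrite adjacent-∷ s S (proj₁ f) (proj₂ f) with sameEdgeᵇ s f in s~f
... | true  = cong suc (Σˡ-zero S (All.map (λ s≁t → 𝟙-false λ t~f → s≁t (SameEdge-trans (sameEdgeᵇ-sound s f s~f)
                                                              (SameEdge-sym (sameEdgeᵇ-sound _ f t~f)))) s-fresh))
... | false = Σ-sameEdge S f distinct f∈S

Σ-occurs : ∀ S B → Distinct S → Distinct B → B ⊑ᵇ S ≡ true → Σˡ S (λ s → 𝟙 (occursᵇ s B)) ≡ length B
Σ-occurs S []      _         _                  _     = Σˡ-zero S (All.universal (λ _ → refl) S)
Σ-occurs S (f ∷ B) distinctS (f-fresh ∷ distinctB) f∷B⊑S = begin
  Σˡ S (λ s → 𝟙 (sameEdgeᵇ s f ∨ occursᵇ s B))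
    ≡⟨ Σˡ-cong S (λ s → 𝟙-∨ (sameEdgeᵇ s f) _ (λ s~f → occursᵇ-fresh s f B s~f f-fresh)) ⟩
  Σˡ S (λ s → 𝟙 (sameEdgeᵇ s f) + 𝟙 (occursᵇ s B))
    ≡⟨ Σˡ-+ S _ _ ⟩
  Σˡ S (λ s → 𝟙 (sameEdgeᵇ s f)) + Σˡ S (λ s → 𝟙 (occursᵇ s B))
    ≡⟨ cong₂ _+_ (Σ-sameEdge S f distinctS (∧-conicalˡ _ _ f∷B⊑S)) (Σ-occurs S B distinctS distinctB (∧-conicalʳ _ _ f∷B⊑S)) ⟩
  suc (length B) ∎
  where open ≡-Reasoning

-- B ⊑ S survives the removal of exactly the |S| - |B| edges of S outside B.
Σ-⊑ᵇ-removeAt : ∀ S B → Distinct S → Distinct B →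
  Σˡ (allFin (length S)) (λ i → 𝟙 (B ⊑ᵇ removeAt S i)) ≡ (length S ∸ length B) * 𝟙 (B ⊑ᵇ S)
Σ-⊑ᵇ-removeAt S B distinctS distinctB = by-cases (B ⊑ᵇ S) refl
  where
  open ≡-Reasoning
  survives : ∀ i {b} → B ⊑ᵇ S ≡ b → B ⊑ᵇ removeAt S i ≡ b ∧ not (occursᵇ (lookup S i) B)
  survives i refl = ⊑ᵇ-removeAt S i B distinctS
  complement : B ⊑ᵇ S ≡ true → Σˡ S (λ s → 𝟙 (not (occursᵇ s B))) + length B ≡ length S
  complement B⊑S = cong (_+_ (Σˡ S (λ s → 𝟙 (not (occursᵇ s B))))) (sym (Σ-occurs S B distinctS distinctB B⊑S))
                 ∙ sym (Σˡ-+ S _ _) ∙ Σˡ-cong S (λ s → 𝟙-not (occursᵇ s B)) ∙ Σˡ-1 S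
  by-cases : ∀ b → B ⊑ᵇ S ≡ b → Σˡ (allFin (length S)) (λ i → 𝟙 (B ⊑ᵇ removeAt S i)) ≡ (length S ∸ length B) * 𝟙 b
  by-cases false B⊑S =
    Σˡ-zero (allFin (length S)) (All.universal (λ i → cong 𝟙 (survives i B⊑S)) _) ∙ sym (*-zeroʳ (length S ∸ length B))
  by-cases true  B⊑S = begin
    Σˡ (allFin (length S)) (λ i → 𝟙 (B ⊑ᵇ removeAt S i))            ≡⟨ Σˡ-cong (allFin (length S)) (λ i → cong 𝟙 (survives i B⊑S)) ⟩
    Σˡ (allFin (length S)) (λ i → 𝟙 (not (occursᵇ (lookup S i) B))) ≡⟨ Σˡ-lookup S (λ s → 𝟙 (not (occursᵇ s B))) ⟩
    Σˡ S (λ s → 𝟙 (not (occursᵇ s B)))                               ≡⟨ m+n∸n≡m _ (length B) ⟨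
    Σˡ S (λ s → 𝟙 (not (occursᵇ s B))) + length B ∸ length B         ≡⟨ cong (_∸ length B) (complement B⊑S) ⟩
    length S ∸ length B                                              ≡⟨ *-identityʳ (length S ∸ length B) ⟨
    (length S ∸ length B) * 1                                        ∎

-- Reservoir sampling

inSample : List Edge → State → ℚ
inSample A st = ⟦ 𝟙 (A ⊑ᵇ sample st) ⟧

module Reservoir (M N : ℕ) .{{_ : NonZero M}} where

  record Sound (Q : List Edge) (st : State) : Set where
    field
      sample⊆  : sample st ⊆ Q
      distinct : Distinct (sample st)
      loopless : All Loopless (sample st)
      bounded  : All (Bounded N) (sample st)
      counts   : CountsTriangles N st
  open Sound

  record Good (Q : List Edge) (st : State) : Set where
    field
      sound : Sound Q st
      size  : length (sample st) ≡ length Q ⊓ M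
  open Good

  -- Before the reservoir is full nothing is random: the sample is the whole stream.
  Filling : List Edge → Dist State → Set
  Filling Q d = Σ State λ st → d ≡ return st × sample st ≡ Q

  Uniform : List Edge → Dist State → Set
  Uniform Q d = ∀ A → Distinct A → length A ≤ M → 𝔼 d (inSample A) ≡ ⟦ 𝟙 (A ⊑ᵇ Q) ⟧ ℚ.* π M (length A) (length Q)

  Invariant : List Edge → Dist State → Set
  Invariant Q d = Always (Good Q) d × (length Q ≤ M → Filling Q d) × (M ≤ length Q → Uniform Q d)

  mkSound : ∀ {Q st S} → sample st ≡ S → S ⊆ Q → Distinct S → All Loopless S → All (Bounded N) S →
            CountsTriangles N st → Sound Q st
  mkSound refl S⊆Q distinct loopless bounded counts = record
    { sample⊆ = S⊆Q ; distinct = distinct ; loopless = loopless ; bounded = bounded ; counts = counts }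

  removeIndex-sound : ∀ {Q} st i → Sound Q st → Sound Q (removeIndex st i)
  removeIndex-sound st i s = mkSound (sample-removeIndex st i) (⊆-trans (removeAt-⊆ S i) (sample⊆ s))
    (Distinct-removeAt S i (distinct s)) (anti-mono (removeAt-⊆ S i) (loopless s)) (anti-mono (removeAt-⊆ S i) (bounded s))
    (removeIndex-counts N st i (distinct s) (loopless s) (bounded s) (counts s))
    where S = sample st

  insertEdge-sound : ∀ {Q} e st → Fresh e Q → Loopless e → Bounded N e → Sound Q st → Sound (e ∷ Q) (insertEdge e st)
  insertEdge-sound e st e-fresh e-loopless e-bounded s = mkSound (sample-insertEdge e st) (∷⁺ʳ e (sample⊆ s))
    (fresh ∷ distinct s) (e-loopless ∷ loopless s) (e-bounded ∷ bounded s)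
    (insertEdge-counts N e st e-loopless e-bounded fresh (loopless s) (bounded s) (counts s))
    where fresh = anti-mono (sample⊆ s) e-fresh

  Sound-∷ : ∀ {Q} e st → Sound Q st → Sound (e ∷ Q) st
  Sound-∷ {Q} e st s = record
    { sample⊆ = ⊆-trans (sample⊆ s) (xs⊆x∷xs Q e) ; distinct = distinct s ; loopless = loopless s ; bounded = bounded s
    ; counts = counts s }

  module Step (Q : List Edge) (e : Edge) (e-fresh : Fresh e Q) (e-loopless : Loopless e) (e-bounded : Bounded N e) where

    t t₁ : ℕ
    t = length Q
    t₁ = suc t

    stepTriest-fill : ∀ st → t₁ ≤ M → stepTriest M t₁ e st ≡ return (insertEdge e st)
    stepTriest-fill st t₁≤M rewrite ≤ᵇ-true t₁≤M = refl

    fill-step : ∀ d → Invariant Q d → t₁ ≤ M → Invariant (e ∷ Q) (d >>= stepTriest M t₁ e)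
    fill-step d (goods , filling , _) t₁≤M with filling (≤-trans (n≤1+n t) t₁≤M)
    ... | st , refl , sample≡Q =
      subst (Invariant (e ∷ Q)) (sym stepped) (goodT ∷ [] , (λ _ → insertEdge e st , refl , sample′) , uniform)
      where
      stepped : return st >>= stepTriest M t₁ e ≡ return (insertEdge e st)
      stepped = >>=-identityˡ st (stepTriest M t₁ e) ∙ stepTriest-fill st t₁≤M
      sample′ : sample (insertEdge e st) ≡ e ∷ Q
      sample′ = sample-insertEdge e st ∙ cong (e ∷_) sample≡Q
      goodT : Good (e ∷ Q) (insertEdge e st)
      goodT = record
        { sound = insertEdge-sound e st e-fresh e-loopless e-bounded (sound (All.head goods))
        ; size  = cong length sample′ ∙ sym (m≤n⇒m⊓n≡m t₁≤M) }
      uniform : M ≤ t₁ → Uniform (e ∷ Q) (return (insertEdge e st))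
      uniform M≤t₁ A _ k≤M = begin
        𝔼 (return (insertEdge e st)) (inSample A)  ≡⟨ 𝔼-return (insertEdge e st) (inSample A) ⟩
        ⟦ 𝟙 (A ⊑ᵇ sample (insertEdge e st)) ⟧       ≡⟨ cong (λ S → ⟦ 𝟙 (A ⊑ᵇ S) ⟧) sample′ ⟩
        ⟦ 𝟙 (A ⊑ᵇ (e ∷ Q)) ⟧                        ≡⟨ ℚ.*-identityʳ _ ⟨
        ⟦ 𝟙 (A ⊑ᵇ (e ∷ Q)) ⟧ ℚ.* 1ℚ                 ≡⟨ cong (⟦ 𝟙 (A ⊑ᵇ (e ∷ Q)) ⟧ ℚ.*_) (π-self k≤M) ⟨
        ⟦ 𝟙 (A ⊑ᵇ (e ∷ Q)) ⟧ ℚ.* π M (length A) M   ≡⟨ cong (λ n → ⟦ 𝟙 (A ⊑ᵇ (e ∷ Q)) ⟧ ℚ.* π M (length A) n)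
                                                                 (≤-antisym M≤t₁ t₁≤M) ⟩
        ⟦ 𝟙 (A ⊑ᵇ (e ∷ Q)) ⟧ ℚ.* π M (length A) t₁  ∎
        where open ≡-Reasoning

    module _ (M≤t : M ≤ t) where

      M<t₁ : M < t₁
      M<t₁ = s≤s M≤t

      heads tails : State → Dist State
      heads st = map (λ i → (frac M t₁ ℚ.* frac 1 M , insertEdge e (removeIndex st i))) (allFin (length (sample st)))
      tails st = (1ℚ ℚ.- frac M t₁ , st) ∷ []

      stepTriest-replace : ∀ st → stepTriest M t₁ e st ≡ heads st ++ tails st
      stepTriest-replace st rewrite ≤ᵇ-false M<t₁ = refl

      full : ∀ {st} → Good Q st → length (sample st) ≡ M
      full g = size g ∙ m≥n⇒m⊓n≡n M≤t

      t₁⊓M : t₁ ⊓ M ≡ M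
      t₁⊓M = m≥n⇒m⊓n≡n (≤-trans M≤t (n≤1+n t))

      replace-good : ∀ st → Good Q st → Always (Good (e ∷ Q)) (stepTriest M t₁ e st)
      replace-good st g = subst (Always (Good (e ∷ Q))) (sym (stepTriest-replace st))
        (++⁺ (map⁺ (tabulate⁺ head-good)) (tail-good ∷ []))
        where
        S = sample st
        head-good : ∀ i → Good (e ∷ Q) (insertEdge e (removeIndex st i))
        head-good i = record
          { sound = insertEdge-sound e (removeIndex st i) e-fresh e-loopless e-bounded (removeIndex-sound st i (sound g))
          ; size  = cong length (sample-insertEdge e (removeIndex st i)) ∙ cong (suc ∘ length) (sample-removeIndex st i)
                  ∙ sym (length-removeAt′ S i) ∙ full g ∙ sym t₁⊓M }
        tail-good : Good (e ∷ Q) st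
        tail-good = record { sound = Sound-∷ e st (sound g) ; size = full g ∙ sym t₁⊓M }

      𝔼-replace : ∀ st → Good Q st → ∀ A → Distinct A →
        𝔼 (stepTriest M t₁ e st) (inSample A)
          ≡ frac 1 t₁ ℚ.* ⟦ (M ∸ length (deleteEdge e A)) * 𝟙 (deleteEdge e A ⊑ᵇ sample st) ⟧ ℚ.+ frac (t₁ ∸ M) t₁ ℚ.* inSample A st
      𝔼-replace st g A distinctA = begin
        𝔼 (stepTriest M t₁ e st) (inSample A)
          ≡⟨ cong (λ d → 𝔼 d (inSample A)) (stepTriest-replace st) ∙ 𝔼-++ (heads st) (tails st) (inSample A) ⟩
        𝔼 (heads st) (inSample A) ℚ.+ 𝔼 (tails st) (inSample A)
          ≡⟨ cong₂ ℚ._+_ (𝔼-uniform _ (allFin (length S)) (λ i → insertEdge e (removeIndex st i)) (λ s → 𝟙 (A ⊑ᵇ sample s)))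
                         (ℚ.+-identityʳ _) ⟩
        frac M t₁ ℚ.* frac 1 M ℚ.* ⟦ Σˡ (allFin (length S)) (λ i → 𝟙 (A ⊑ᵇ sample (insertEdge e (removeIndex st i)))) ⟧
          ℚ.+ (1ℚ ℚ.- frac M t₁) ℚ.* inSample A st
          ≡⟨ cong₂ (λ w n → w ℚ.* ⟦ n ⟧ ℚ.+ (1ℚ ℚ.- frac M t₁) ℚ.* inSample A st) (frac-*-frac-1 M t₁) (Σˡ-cong (allFin (length S)) survivors) ⟩
        frac 1 t₁ ℚ.* ⟦ Σˡ (allFin (length S)) (λ i → 𝟙 (B ⊑ᵇ removeAt S i)) ⟧ ℚ.+ (1ℚ ℚ.- frac M t₁) ℚ.* inSample A st
          ≡⟨ cong₂ (λ n p → frac 1 t₁ ℚ.* ⟦ n ⟧ ℚ.+ p ℚ.* inSample A st)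
                   (Σ-⊑ᵇ-removeAt S B (distinct (sound g)) (Distinct-deleteEdge e A distinctA) ∙ cong (λ m → (m ∸ length B) * 𝟙 (B ⊑ᵇ S)) (full g))
                   (1-frac M t₁ (<⇒≤ M<t₁)) ⟩
        frac 1 t₁ ℚ.* ⟦ (M ∸ length B) * 𝟙 (B ⊑ᵇ S) ⟧ ℚ.+ frac (t₁ ∸ M) t₁ ℚ.* inSample A st ∎
        where
        open ≡-Reasoning
        S = sample st
        B = deleteEdge e A
        survivors : ∀ i → 𝟙 (A ⊑ᵇ sample (insertEdge e (removeIndex st i))) ≡ 𝟙 (B ⊑ᵇ removeAt S i)
        survivors i = cong 𝟙 (cong (A ⊑ᵇ_) (sample-insertEdge e (removeIndex st i)) ∙ ⊑ᵇ-∷ e (sample (removeIndex st i)) A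
                              ∙ cong (B ⊑ᵇ_) (sample-removeIndex st i))

      𝔼-replace-absent : ∀ st → Good Q st → ∀ A → Distinct A → length A ≤ M → occursᵇ e A ≡ false →
        𝔼 (stepTriest M t₁ e st) (inSample A) ≡ frac (t₁ ∸ length A) t₁ ℚ.* inSample A st
      𝔼-replace-absent st g A distinctA k≤M absent = begin
        𝔼 (stepTriest M t₁ e st) (inSample A)
          ≡⟨ 𝔼-replace st g A distinctA ∙ cong (λ B → frac 1 t₁ ℚ.* ⟦ (M ∸ length B) * 𝟙 (B ⊑ᵇ sample st) ⟧ ℚ.+ frac (t₁ ∸ M) t₁ ℚ.* inSample A st)
                                               (deleteEdge-absent e A absent) ⟩
        frac 1 t₁ ℚ.* ⟦ (M ∸ k) * 𝟙 (A ⊑ᵇ sample st) ⟧ ℚ.+ frac (t₁ ∸ M) t₁ ℚ.* inSample A st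
          ≡⟨ cong (ℚ._+ frac (t₁ ∸ M) t₁ ℚ.* inSample A st) (frac-1* (M ∸ k) (𝟙 (A ⊑ᵇ sample st)) t₁) ⟩
        frac (M ∸ k) t₁ ℚ.* inSample A st ℚ.+ frac (t₁ ∸ M) t₁ ℚ.* inSample A st
          ≡⟨ frac-+-distrib (M ∸ k) (t₁ ∸ M) t₁ (inSample A st) ⟩
        frac (M ∸ k + (t₁ ∸ M)) t₁ ℚ.* inSample A st
          ≡⟨ cong (λ n → frac n t₁ ℚ.* inSample A st) (+-comm (M ∸ k) (t₁ ∸ M) ∙ sym (+-∸-assoc (t₁ ∸ M) k≤M) ∙ cong (_∸ k) (m∸n+n≡m (<⇒≤ M<t₁))) ⟩
        frac (t₁ ∸ k) t₁ ℚ.* inSample A st ∎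
        where
        open ≡-Reasoning
        k = length A

      -- A set containing the new edge can only be in the sample if a head put the new edge in.
      𝔼-replace-occurs : ∀ st → Good Q st → ∀ A → Distinct A → occursᵇ e A ≡ true →
        𝔼 (stepTriest M t₁ e st) (inSample A) ≡ frac (M ∸ length (deleteEdge e A)) t₁ ℚ.* inSample (deleteEdge e A) st
      𝔼-replace-occurs st g A distinctA occurs = begin
        𝔼 (stepTriest M t₁ e st) (inSample A)
          ≡⟨ 𝔼-replace st g A distinctA ⟩
        frac 1 t₁ ℚ.* ⟦ (M ∸ length B) * 𝟙 (B ⊑ᵇ sample st) ⟧ ℚ.+ frac (t₁ ∸ M) t₁ ℚ.* ⟦ 𝟙 (A ⊑ᵇ sample st) ⟧
          ≡⟨ cong (λ b → frac 1 t₁ ℚ.* ⟦ (M ∸ length B) * 𝟙 (B ⊑ᵇ sample st) ⟧ ℚ.+ frac (t₁ ∸ M) t₁ ℚ.* ⟦ 𝟙 b ⟧)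
                  (⊑ᵇ-non-edge (sample st) e A occurs (adjacent-fresh e (sample st) (anti-mono (sample⊆ (sound g)) e-fresh))) ⟩
        frac 1 t₁ ℚ.* ⟦ (M ∸ length B) * 𝟙 (B ⊑ᵇ sample st) ⟧ ℚ.+ frac (t₁ ∸ M) t₁ ℚ.* ⟦ 0 ⟧
          ≡⟨ cong (λ z → frac 1 t₁ ℚ.* ⟦ (M ∸ length B) * 𝟙 (B ⊑ᵇ sample st) ⟧ ℚ.+ frac (t₁ ∸ M) t₁ ℚ.* z) ⟦0⟧≡0ℚ
           ∙ cong (frac 1 t₁ ℚ.* ⟦ (M ∸ length B) * 𝟙 (B ⊑ᵇ sample st) ⟧ ℚ.+_) (ℚ.*-zeroʳ (frac (t₁ ∸ M) t₁))
           ∙ ℚ.+-identityʳ _ ∙ frac-1* (M ∸ length B) (𝟙 (B ⊑ᵇ sample st)) t₁ ⟩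
        frac (M ∸ length B) t₁ ℚ.* inSample B st ∎
        where
        open ≡-Reasoning
        B = deleteEdge e A

      module _ (d : Dist State) (goods : Always (Good Q) d) (uniform : Uniform Q d)
               (A : List Edge) (distinctA : Distinct A) (k≤M : length A ≤ M) where

        uniform-absent : occursᵇ e A ≡ false → 𝔼 (d >>= stepTriest M t₁ e) (inSample A) ≡ ⟦ 𝟙 (A ⊑ᵇ (e ∷ Q)) ⟧ ℚ.* π M (length A) t₁
        uniform-absent absent = begin
          𝔼 (d >>= stepTriest M t₁ e) (inSample A)             ≡⟨ 𝔼-bind d (stepTriest M t₁ e) (inSample A) ⟩
          𝔼 d (λ st → 𝔼 (stepTriest M t₁ e st) (inSample A))   ≡⟨ 𝔼-cong d (All.map (λ {px} g → 𝔼-replace-absent (proj₂ px) g A distinctA k≤M absent) goods) ⟩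
          𝔼 d (λ st → frac (t₁ ∸ k) t₁ ℚ.* inSample A st)       ≡⟨ 𝔼-scale d (frac (t₁ ∸ k) t₁) (inSample A) ⟩
          frac (t₁ ∸ k) t₁ ℚ.* 𝔼 d (inSample A)                 ≡⟨ cong (frac (t₁ ∸ k) t₁ ℚ.*_) (uniform A distinctA k≤M) ⟩
          frac (t₁ ∸ k) t₁ ℚ.* (⟦ 𝟙 (A ⊑ᵇ Q) ⟧ ℚ.* π M k t) ≡⟨ *-left-comm (frac (t₁ ∸ k) t₁) ⟦ 𝟙 (A ⊑ᵇ Q) ⟧ (π M k t) ⟩
          ⟦ 𝟙 (A ⊑ᵇ Q) ⟧ ℚ.* (frac (t₁ ∸ k) t₁ ℚ.* π M k t) ≡⟨ cong (⟦ 𝟙 (A ⊑ᵇ Q) ⟧ ℚ.*_) (π-survive t (≤-trans k≤M M≤t)) ⟩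
          ⟦ 𝟙 (A ⊑ᵇ Q) ⟧ ℚ.* π M k t₁                  ≡⟨ cong (λ b → ⟦ 𝟙 b ⟧ ℚ.* π M k t₁) (cong (_⊑ᵇ Q) (sym (deleteEdge-absent e A absent)) ∙ sym (⊑ᵇ-∷ e Q A)) ⟩
          ⟦ 𝟙 (A ⊑ᵇ (e ∷ Q)) ⟧ ℚ.* π M k t₁ ∎
          where
          open ≡-Reasoning
          k = length A

        uniform-occurs : occursᵇ e A ≡ true → 𝔼 (d >>= stepTriest M t₁ e) (inSample A) ≡ ⟦ 𝟙 (A ⊑ᵇ (e ∷ Q)) ⟧ ℚ.* π M (length A) t₁
        uniform-occurs occurs = begin
          𝔼 (d >>= stepTriest M t₁ e) (inSample A)             ≡⟨ 𝔼-bind d (stepTriest M t₁ e) (inSample A) ⟩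
          𝔼 d (λ st → 𝔼 (stepTriest M t₁ e st) (inSample A))   ≡⟨ 𝔼-cong d (All.map (λ {px} g → 𝔼-replace-occurs (proj₂ px) g A distinctA occurs) goods) ⟩
          𝔼 d (λ st → frac (M ∸ k′) t₁ ℚ.* inSample B st)      ≡⟨ 𝔼-scale d (frac (M ∸ k′) t₁) (inSample B) ⟩
          frac (M ∸ k′) t₁ ℚ.* 𝔼 d (inSample B)                ≡⟨ cong (frac (M ∸ k′) t₁ ℚ.*_) (uniform B (Distinct-deleteEdge e A distinctA) k′≤M) ⟩
          frac (M ∸ k′) t₁ ℚ.* (⟦ 𝟙 (B ⊑ᵇ Q) ⟧ ℚ.* π M k′ t) ≡⟨ *-left-comm (frac (M ∸ k′) t₁) ⟦ 𝟙 (B ⊑ᵇ Q) ⟧ (π M k′ t) ⟩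
          ⟦ 𝟙 (B ⊑ᵇ Q) ⟧ ℚ.* (frac (M ∸ k′) t₁ ℚ.* π M k′ t) ≡⟨ cong (⟦ 𝟙 (B ⊑ᵇ Q) ⟧ ℚ.*_) (π-enter t (≤-trans k′≤M M≤t)) ⟩
          ⟦ 𝟙 (B ⊑ᵇ Q) ⟧ ℚ.* π M (suc k′) t₁            ≡⟨ cong₂ (λ b k → ⟦ 𝟙 b ⟧ ℚ.* π M k t₁) (sym (⊑ᵇ-∷ e Q A)) (length-deleteEdge-occurs e A distinctA occurs) ⟩
          ⟦ 𝟙 (A ⊑ᵇ (e ∷ Q)) ⟧ ℚ.* π M (length A) t₁ ∎
          where
          open ≡-Reasoning
          B = deleteEdge e A
          k′ = length B
          k′≤M = ≤-trans (length-deleteEdge-≤ e A) k≤M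

      replace-step : ∀ d → Invariant Q d → Invariant (e ∷ Q) (d >>= stepTriest M t₁ e)
      replace-step d (goods , _ , uniform) =
        Always-bind d (stepTriest M t₁ e) (All.map (λ {px} → replace-good (proj₂ px)) goods) ,
        (λ t₁≤M → ⊥-elim (<⇒≱ M<t₁ t₁≤M)) ,
        (λ _ → uniform′)
        where
        uniform′ : Uniform (e ∷ Q) (d >>= stepTriest M t₁ e)
        uniform′ A distinctA k≤M with occursᵇ e A in occ
        ... | false = uniform-absent d goods (uniform M≤t) A distinctA k≤M occ
        ... | true  = uniform-occurs d goods (uniform M≤t) A distinctA k≤M occ

  step : ∀ Q d e → Invariant Q d → Fresh e Q → Loopless e → Bounded N e →
         Invariant (e ∷ Q) (d >>= stepTriest M (suc (length Q)) e)
  step Q d e inv fresh loopless bounded with suc (length Q) ≤? M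
  ... | yes t₁≤M = Step.fill-step Q e fresh loopless bounded d inv t₁≤M
  ... | no  t₁≰M = Step.replace-step Q e fresh loopless bounded (≤-pred (≰⇒> t₁≰M)) d inv

  -- The stream is consumed from the front, so the processed prefix is kept reversed.
  run-invariant : ∀ R Q d → Invariant Q d → ValidStream R → All (Bounded N) R → All (λ r → Fresh r Q) R →
                  Invariant (R ʳ++ Q) (runFrom M (length Q) R d)
  run-invariant []      Q d inv _ _ _ = inv
  run-invariant (r ∷ R) Q d inv (r-loopless ∷ loopless , r-new ∷ distinct) (r-bounded ∷ bounded) (r-fresh ∷ fresh) =
    run-invariant R (r ∷ Q) _ (step Q d r inv r-fresh r-loopless r-bounded) (loopless , distinct) bounded
      (All.zipWith (λ (r≁r′ , r′-fresh) → (λ r′~r → r≁r′ (SameEdge-sym r′~r)) ∷ r′-fresh) (r-new , fresh))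

  initial : Invariant [] (return initState)
  initial = record { sound = mkSound refl (λ ()) [] [] [] (cong +_ (sym (triangles<-empty N))) ; size = refl } ∷ [] ,
            (λ _ → initState , refl , refl) ,
            (λ M≤0 → ⊥-elim (≢-nonZero⁻¹ M (n≤0⇒n≡0 M≤0)))

  module _ (Q : List Edge) (d : Dist State) (uniform : Uniform Q d) where

    𝔼-guarded : ∀ o A → (o ≡ true → Distinct A) → length A ≤ M →
      𝔼 d (λ s → ⟦ 𝟙 (o ∧ A ⊑ᵇ sample s) ⟧) ≡ ⟦ 𝟙 (o ∧ A ⊑ᵇ Q) ⟧ ℚ.* π M (length A) (length Q)
    𝔼-guarded false A _        _   = 𝔼-⟦0⟧ d (π M (length A) (length Q))
    𝔼-guarded true  A distinct k≤M = uniform A (distinct refl) k≤M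

    𝔼-triangle : 3 ≤ M → ∀ u v w →
      𝔼 d (λ s → ⟦ 𝟙 (triangleᵇ (adjacent (sample s)) u v w) ⟧) ≡ ⟦ 𝟙 (triangleᵇ (adjacent Q) u v w) ⟧ ℚ.* π M 3 (length Q)
    𝔼-triangle 3≤M u v w =
      𝔼-congᵖ d (λ s → cong (λ b → ⟦ 𝟙 b ⟧) (guarded (sample s)))
      ∙ 𝔼-guarded ordered triangle triangle-distinct 3≤M
      ∙ cong (λ b → ⟦ 𝟙 b ⟧ ℚ.* π M 3 (length Q)) (sym (guarded Q))
      where
      ordered = (u <ᵇ v) ∧ (v <ᵇ w)
      triangle : List Edge
      triangle = (u , v) ∷ (v , w) ∷ (w , u) ∷ []
      guarded : ∀ S → triangleᵇ (adjacent S) u v w ≡ ordered ∧ triangle ⊑ᵇ S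
      guarded S = sym (∧-assoc (u <ᵇ v) (v <ᵇ w) _)
                ∙ cong (λ b → ordered ∧ adjacent S u v ∧ adjacent S v w ∧ b) (sym (∧-identityʳ (adjacent S w u)))
      triangle-distinct : ordered ≡ true → Distinct triangle
      triangle-distinct o = ((λ { (inj₁ (p , q)) → <⇒≢ u<w (trans p q) ; (inj₂ (p , _)) → <⇒≢ u<w p })
                          ∷ (λ { (inj₁ (p , _)) → <⇒≢ u<w p ; (inj₂ (_ , q)) → <⇒≢ v<w q }) ∷ [])
                          ∷ ((λ { (inj₁ (p , _)) → <⇒≢ v<w p ; (inj₂ (p , _)) → <⇒≢ u<v (sym p) }) ∷ []) ∷ [] ∷ []
        where
        u<v = <ᵇ-sound (∧-conicalˡ _ _ o)
        v<w = <ᵇ-sound (∧-conicalʳ _ _ o)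
        u<w = <-trans u<v v<w

  𝔼-τ : ∀ Q d → Invariant Q d → 3 ≤ M → M ≤ length Q →
        𝔼 d (λ s → toℚ (τ s)) ≡ ⟦ triangles< N (adjacent Q) ⟧ ℚ.* π M 3 (length Q)
  𝔼-τ Q d (goods , _ , uniform) 3≤M M≤t = begin
    𝔼 d (λ s → toℚ (τ s))
      ≡⟨ 𝔼-cong d (All.map (λ g → cong toℚ (counts (sound g))) goods) ⟩
    𝔼 d (λ s → ⟦ triangles< N (adjacent (sample s)) ⟧)
      ≡⟨ 𝔼-Σ< d N (λ s u → Σ<² (adjacent (sample s)) u) (Σ<² (adjacent Q)) p (λ u _ →
         𝔼-Σ< d N (λ s v → Σ<¹ (adjacent (sample s)) u v) (Σ<¹ (adjacent Q) u) p (λ v _ →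
         𝔼-Σ< d N (λ s w → 𝟙 (triangleᵇ (adjacent (sample s)) u v w)) (λ w → 𝟙 (triangleᵇ (adjacent Q) u v w)) p (λ w _ →
         𝔼-triangle Q d (uniform M≤t) 3≤M u v w))) ⟩
    ⟦ triangles< N (adjacent Q) ⟧ ℚ.* p ∎
    where
    open ≡-Reasoning
    p = π M 3 (length Q)
    Σ<¹ : Graph → ℕ → ℕ → ℕ
    Σ<¹ adj u v = Σ< N λ w → 𝟙 (triangleᵇ adj u v w)
    Σ<² : Graph → ℕ → ℕ
    Σ<² adj u = Σ< N λ v → Σ<¹ adj u v

  exact : ∀ Q d → Invariant Q d → length Q ≤ M →
    Always (λ s → (ξ M 3 (length Q) ℚ.* toℚ (τ s) ≡ toℚ (τ s)) × (τ s ≡ + triangles< N (adjacent Q))) d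
  exact Q d (goods , filling , _) t≤M with filling t≤M
  ... | st , refl , sample≡Q =
    (ξ-one , counts (sound (All.head goods)) ∙ cong (λ S → + triangles< N (adjacent S)) sample≡Q) ∷ []
    where
    ξ-one : ξ M 3 (length Q) ℚ.* toℚ (τ st) ≡ toℚ (τ st)
    ξ-one rewrite ≤ᵇ-true t≤M = ℚ.*-identityˡ (toℚ (τ st))

  unbiased : ∀ Q d → Invariant Q d → 3 ≤ M → M < length Q →
    𝔼 d (λ s → ξ M 3 (length Q) ℚ.* toℚ (τ s)) ≡ ⟦ triangles< N (adjacent Q) ⟧
  unbiased Q d invariant 3≤M M<t = begin
    𝔼 d (λ s → ξ′ ℚ.* toℚ (τ s))  ≡⟨ 𝔼-scale d ξ′ (λ s → toℚ (τ s)) ⟩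
    ξ′ ℚ.* 𝔼 d (λ s → toℚ (τ s))  ≡⟨ cong (ξ′ ℚ.*_) (𝔼-τ Q d invariant 3≤M (<⇒≤ M<t)) ⟩
    ξ′ ℚ.* (⟦ Δ ⟧ ℚ.* π M 3 t)    ≡⟨ *-left-comm ξ′ ⟦ Δ ⟧ (π M 3 t) ⟩
    ⟦ Δ ⟧ ℚ.* (ξ′ ℚ.* π M 3 t)    ≡⟨ cong (⟦ Δ ⟧ ℚ.*_) (ξ-π M t 3≤M M<t) ⟩
    ⟦ Δ ⟧ ℚ.* 1ℚ                  ≡⟨ ℚ.*-identityʳ ⟦ Δ ⟧ ⟩
    ⟦ Δ ⟧                         ∎
    where
    open ≡-Reasoning
    t = length Q
    ξ′ = ξ M 3 t
    Δ = triangles< N (adjacent Q)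

theorem4p2 : (M : ℕ) → 6 ≤ M → (es : List Edge) → ValidStream es →
  (length es ≤ M →
    All (λ ps → (ξ M 3 (length es) ℚ.* toℚ (τ (proj₂ ps)) ≡ toℚ (τ (proj₂ ps)))
              × (τ (proj₂ ps) ≡ + numTriangles es))
        (run M es))
  × (M < length es →
    𝔼 (run M es) (λ s → ξ M 3 (length es) ℚ.* toℚ (τ s)) ≡ toℚ (+ numTriangles es))
theorem4p2 M 6≤M es valid = subst Exact |Q| exact-Q , subst Unbiased |Q| unbiased-Q
  where
  instance _ = >-nonZero (≤-trans (s≤s z≤n) 6≤M)
  N = suc (maxVertex es)
  open Reservoir M N
  Q = es ʳ++ []
  |Q| : length Q ≡ length es
  |Q| = length-reverse es
  invariant : Invariant Q (run M es)
  invariant = run-invariant es [] (return initState) initial valid (Bounded-maxVertex es) (All.universal (λ _ → []) es)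
  triangles≡ : numTriangles es ≡ triangles< N (adjacent Q)
  triangles≡ = numTriangles≡triangles< N es (Bounded-maxVertex es)
             ∙ triangles<-cong N (λ x y → sym (adjacent-ʳ++ es [] x y ∙ ∨-identityʳ (adjacent es x y)))
  Exact Unbiased : ℕ → Set
  Exact t = t ≤ M → Always (λ s → (ξ M 3 t ℚ.* toℚ (τ s) ≡ toℚ (τ s)) × (τ s ≡ + numTriangles es)) (run M es)
  Unbiased t = M < t → 𝔼 (run M es) (λ s → ξ M 3 t ℚ.* toℚ (τ s)) ≡ toℚ (+ numTriangles es)
  exact-Q : Exact (length Q)
  exact-Q t≤M = All.map (λ (ξ≡ , τ≡) → ξ≡ , τ≡ ∙ cong +_ (sym triangles≡)) (exact Q (run M es) invariant t≤M)
  unbiased-Q : Unbiased (length Q)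
  unbiased-Q M<t =
    unbiased Q (run M es) invariant (≤-trans (s≤s (s≤s (s≤s z≤n))) 6≤M) M<t ∙ cong ⟦_⟧ (sym triangles≡)
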